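{- Let $k\ge 2$, $q\ge1$ and let $\mathbf{v}\in W_{k,q}$ be a vertex of $T_{k,q}$ with $\mathrm{type}(\mathbf{v})=(\alpha_0;\alpha_1,\ldots,\alpha_{s-1};\alpha_s)$. Let $P_{\mathbf{v}}=C_{\alpha_0+\alpha_s+1}\times C_{\alpha_1}\times\cdots\times C_{\alpha_{s-1}}$ be the product of $s$ chains of lengths $\alpha_0+\alpha_s+1,\alpha_1,\ldots,\alpha_{s-1}$, and $\overline{P}_{\mathbf{v}}$ the poset obtained by removing its minimum and maximum. Then $\mathrm{link}_{T_{k,q}}(\mathbf{v})\cong\Delta(\overline{P}_{\mathbf{v}})$.
   Context: $R_{k,q}=\{\mathbf{x}\in\mathbb{R}^{k-1}:0\le x_1\le\cdots\le x_{k-1}\le q\}$, $W_{k,q}=R_{k,q}\cap\mathbb{Z}^{k-1}$. A permutation $\pi$ of $[k-1]$ is consistent with $\mathbf{v}\in W_{k,q}$ if $i$ precedes $i+1$ in $\pi$ whenever $v_i=v_{i+1}$; then $F(\mathbf{v},\pi)$ is the simplex with vertices $\mathbf{v}^{(1)}=\mathbf{v}$, $\mathbf{v}^{(m+1)}=\mathbf{v}^{(m)}+e_{\pi_{k-m}}$ ($m=1,\dots,k-1$). $T_{k,q}$ is the simplicial complex on $W_{k,q}$ whose facets are all such $F(\mathbf{v},\pi)$. The type of $\mathbf{v}$: $\alpha_0$ is the number of coordinates of $\mathbf{v}$ equal to $0$, $\alpha_s$ the number equal to $q$, and the coordinates strictly between $0$ and $q$ take $s-1$ distinct values whose multiplicities,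 in increasing order of value, are $\alpha_1,\ldots,\alpha_{s-1}$ (so $\alpha_0,\alpha_s\ge0$, $\alpha_i\ge1$ for $0<i<s$, and $\sum\alpha_i=k-1$). $C_m$ denotes the chain $0<1<\cdots<m$; products carry the componentwise order. $\Delta(P)$ is the order complex of $P$ (faces are chains); $\cong$ means isomorphism of simplicial complexes; $\mathrm{link}_K(\sigma)=\{\tau\in K:\sigma\cup\tau\in K,\sigma\cap\tau=\emptyset\}$. -}

module Defs where

open import Data.Nat using (ℕ; zero; suc; _+_; _≤_; _<_; _≤?_; _≟_)
open import Data.Bool using (if_then_else_)
open import Data.Fin using (Fin; toℕ)
open import Data.Fin.Permutation using (Permutation′; _⟨$⟩ʳ_; _⟨$⟩ˡ_)
open import Data.Vec using (Vec; lookup; tabulate; toList)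
open import Data.List using (List; []; _∷_; length; filter; map; replicate)
open import Data.List.Relation.Unary.All using (All)
open import Data.List.Relation.Unary.AllPairs using (AllPairs)
open import Data.List.Relation.Binary.Pointwise using (Pointwise)
open import Data.List.Membership.Propositional using (_∉_)
open import Data.Product using (Σ; ∃; _×_; _,_)
open import Data.Sum using (_⊎_)
open import Relation.Nullary using (¬_; ⌊_⌋)
open import Relation.Nullary.Decidable using (_×-dec_)
open import Relation.Binary.PropositionalEquality using (_≡_; _≢_)
open import Function.Bundles using (_⇔_)

-- Abstract simplicial complexes, given by their faces.
-- A finite set of vertices is represented by a list (only membership
-- matters); a complex on a vertex type A is a predicate on such lists.

Complex : Set → Set₁
Complex A = List A → Set

IsVertex : ∀ {A} → Complex A → A → Set
IsVertex K a = K (a ∷ [])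

link : ∀ {A} → Complex A → A → Complex A
link K v τ = (v ∉ τ) × K (v ∷ τ)

record _≅_ {A B : Set} (K : Complex A) (L : Complex B) : Set where
  field
    f      : A → B
    g      : B → A
    f-vert : ∀ a → IsVertex K a → IsVertex L (f a)
    g-vert : ∀ b → IsVertex L b → IsVertex K (g b)
    gf     : ∀ a → IsVertex K a → g (f a) ≡ a
    fg     : ∀ b → IsVertex L b → f (g b) ≡ b
    faces  : ∀ (τ : List A) → All (IsVertex K) τ → (K τ ⇔ L (map f τ))

-- W_{k,q}, with n = k - 1 coordinates: 0 ≤ x_1 ≤ ... ≤ x_n ≤ q.

InW : ∀ {n} → ℕ → Vec ℕ n → Set
InW {n} q x = (∀ (i j : Fin n) → toℕ i ≤ toℕ j → lookup x i ≤ lookup x j)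
            × (∀ (i : Fin n) → lookup x i ≤ q)

-- π (a permutation of [n], π_j = π ⟨$⟩ʳ j, 0-indexed positions) is
-- consistent with v: whenever v_i = v_{i+1}, i precedes i+1 in π.
Consistent : ∀ {n} → Vec ℕ n → Permutation′ n → Set
Consistent {n} v π = ∀ (i j : Fin n) → toℕ j ≡ suc (toℕ i) →
  lookup v i ≡ lookup v j → toℕ (π ⟨$⟩ˡ i) < toℕ (π ⟨$⟩ˡ j)

-- The vertices of F(v,π): v^(m+1) = v + e_{π_{k-m}} + ... + e_{π_{k-1}}
-- (1-indexed positions), i.e. v plus the indicator of { π_p : p ≥ t }
-- (0-indexed positions p), t = n - m ranging over 0..n.
vert : ∀ {n} → Vec ℕ n → Permutation′ n → Fin (suc n) → Vec ℕ n
vert v π t = tabulate (λ i → lookup v i +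
  (if ⌊ toℕ t ≤? toℕ (π ⟨$⟩ˡ i) ⌋ then 1 else 0))

-- F(v,π) is a facet of T_{k,q} (a complex on W_{k,q}, so its vertices
-- must lie in W_{k,q}).
IsFacet : ∀ {n} → ℕ → Vec ℕ n → Permutation′ n → Set
IsFacet q v π = InW q v × Consistent v π × (∀ t → InW q (vert v π t))

T : (n q : ℕ) → Complex (Vec ℕ n)
T n q τ = Σ (Vec ℕ n) λ v → Σ (Permutation′ n) λ π →
  IsFacet q v π × All (λ w → ∃ λ t → w ≡ vert v π t) τ

runsFrom : ℕ → ℕ → List ℕ → List ℕ
runsFrom cur c [] = c ∷ []
runsFrom cur c (y ∷ ys) =
  if ⌊ y ≟ cur ⌋ then runsFrom cur (suc c) ys else c ∷ runsFrom y 1 ys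

runs : List ℕ → List ℕ
runs [] = []
runs (x ∷ xs) = runsFrom x 1 xs

record VType : Set where
  constructor vtype
  field
    α₀   : ℕ
    mids : List ℕ
    αₛ   : ℕ

typeOf : ∀ {n} → ℕ → Vec ℕ n → VType
typeOf q v = vtype
  (length (filter (_≟ 0) xs))
  (runs (filter (λ x → (1 ≤? x) ×-dec (suc x ≤? q)) xs))
  (length (filter (_≟ q) xs))
  where xs = toList v

-- Products of chains C_{ℓ₁} × … × C_{ℓ_s} (C_m = {0 < 1 < … < m}),
-- elements are lists x with x_i ≤ ℓ_i, ordered componentwise.

_≤P_ : List ℕ → List ℕ → Set
x ≤P y = Pointwise _≤_ x y

InPbar : List ℕ → List ℕ → Set
InPbar ℓs x = (x ≤P ℓs) × (x ≢ replicate (length ℓs) 0) × (x ≢ ℓs)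

Δbar : List ℕ → Complex (List ℕ)
Δbar ℓs c = All (InPbar ℓs) c × AllPairs (λ x y → (x ≤P y) ⊎ (y ≤P x)) c

chainLengths : VType → List ℕ
chainLengths (vtype a0 ms as) = (a0 + as + 1) ∷ ms

{-# OPTIONS --safe #-}
module Submission where

-- A neighbour w of v in T is v + d − δ·𝟏 for a 0/1 vector d and δ ∈ {0,1}, where δ = 1 iff w
-- is not above v; and the faces of T are exactly the sets of pairwise comparable points of W,
-- comparable meaning w ≤ w′ ≤ w + 𝟏 coordinatewise or the other way round.  As w stays sorted
-- and inside [0,q], d is 1 on a final segment of each block of equal coordinates of v, so d is
-- determined by its number of ones in every block.  On the block of an interior level this
-- number ranges over the chain C_αᵢ.  The blocks at 0 and at q interact with δ (δ = 1 forces d = 1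
-- on the 0-block, δ = 0 forces d = 0 on the q-block), and δ together with their two counts ranges
-- over one chain C_{α₀+αₛ+1}.  The resulting bijection between neighbours of v and P̄_v is an
-- order isomorphism for the componentwise order on (δ, d), and comparability in T corresponds to
-- comparability of the pairs (δ, d); so the link of v is the order complex of P̄_v.

open import Defs
open import Data.Bool using (if_then_else_)
open import Data.Empty using (⊥-elim)
open import Data.Fin using (Fin; toℕ; fromℕ<; punchOut) renaming (zero to fzero; suc to fsuc)
open import Data.Fin.Properties
  using (toℕ-fromℕ<; toℕ-injective; any?; all?; injective⇒≤; punchOut-injective)
  renaming (_≟_ to _≟ᶠ_)
open import Data.Fin.Permutation using (Permutation′; permutation; _⟨$⟩ˡ_)
open import Data.List using (List; []; _∷_; map; filter; length; replicate)
open import Data.List.Extrema.Nat using (min; min≤⊤; min≤xs; v≤min⁺)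
open import Data.List.Membership.Propositional using (_∈_)
open import Data.List.Membership.Propositional.Properties using (∈-filter⁺)
open import Data.List.Properties
  using (map-cong; map-cong-local; length-map; filter-accept; filter-reject)
open import Data.List.Relation.Binary.Pointwise as Pointwise using (Pointwise; []; _∷_)
open import Data.List.Relation.Unary.All as All using (All; []; _∷_)
open import Data.List.Relation.Unary.All.Properties as All using (All¬⇒¬Any; ¬Any⇒All¬; all-filter)
open import Data.List.Relation.Unary.AllPairs as AllPairs using (AllPairs; []; _∷_)
import Data.List.Relation.Unary.AllPairs.Properties as AllPairs
open import Data.List.Relation.Unary.Any using (here; there)
open import Data.Nat
open import Data.Nat.Properties
open import Algebra.Properties.CommutativeMonoid.Sum +-0-commutativeMonoid using (sum; sum-cong-≗)
import Data.Nat.ListAction as List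
open import Data.Product using (∃; _×_; _,_; proj₁; proj₂)
open import Data.Sum as Sum using (_⊎_; inj₁; inj₂; swap; [_,_]′)
open import Data.Vec as Vec using (Vec; lookup; tabulate; toList)
open import Data.Vec.Membership.Propositional.Properties using (∈-lookup; ∈-toList⁺)
open import Data.Vec.Properties using (lookup∘tabulate; tabulate∘lookup; tabulate-cong)
import Data.Vec.Relation.Unary.All.Properties as VecAll
open import Function using (_∘_)
open import Function.Bundles using (_⇔_; mk⇔; Equivalence)
open import Function.Definitions using (Injective)
open import Function.Properties.Equivalence using () renaming (trans to ⇔-trans)
open import Relation.Binary.Definitions using (Reflexive; Symmetric; Transitive; tri<; tri≈; tri>)
open import Relation.Binary.PropositionalEquality
open import Relation.Nullary using (¬_; Dec; yes; no; ⌊_⌋; ¬?)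
open import Relation.Nullary.Decidable using (_×-dec_; _⊎-dec_; map′)
open import Relation.Unary using (Decidable)

private
  variable
    A B : Set
    n : ℕ

𝟙 : Dec A → ℕ
𝟙 d = if ⌊ d ⌋ then 1 else 0

𝟙≤1 : (d : Dec A) → 𝟙 d ≤ 1
𝟙≤1 (yes _) = s≤s z≤n
𝟙≤1 (no _)  = z≤n

𝟙-yes : (d : Dec A) → A → 𝟙 d ≡ 1
𝟙-yes (yes _) _ = refl
𝟙-yes (no ¬a) a = ⊥-elim (¬a a)

𝟙-no : (d : Dec A) → ¬ A → 𝟙 d ≡ 0
𝟙-no (yes a) ¬a = ⊥-elim (¬a a)
𝟙-no (no _)  _  = refl

𝟙≡1⇒ : (d : Dec A) → 𝟙 d ≡ 1 → A
𝟙≡1⇒ (yes a) _ = a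

𝟙-mono : (d : Dec A) (d′ : Dec B) → (A → B) → 𝟙 d ≤ 𝟙 d′
𝟙-mono (yes a) d′ f = ≤-reflexive (sym (𝟙-yes d′ (f a)))
𝟙-mono (no _)  d′ f = z≤n

𝟙-≟-sym : ∀ x y → 𝟙 (x ≟ y) ≡ 𝟙 (y ≟ x)
𝟙-≟-sym x y with x ≟ y | y ≟ x
... | yes _   | yes _   = refl
... | no  _   | no  _   = refl
... | yes x≡y | no  y≢x = ⊥-elim (y≢x (sym x≡y))
... | no  x≢y | yes y≡x = ⊥-elim (x≢y (sym y≡x))

sum-mono-≤ : {f g : Fin n → ℕ} → (∀ i → f i ≤ g i) → sum f ≤ sum g
sum-mono-≤ {zero}  _   = z≤n
sum-mono-≤ {suc n} f≤g = +-mono-≤ (f≤g fzero) (sum-mono-≤ (f≤g ∘ fsuc))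

sum-mono-< : {f g : Fin n → ℕ} → (∀ i → f i ≤ g i) → ∀ i → f i < g i → sum f < sum g
sum-mono-< {suc n} f≤g fzero    fᵢ<gᵢ = +-mono-<-≤ fᵢ<gᵢ (sum-mono-≤ (f≤g ∘ fsuc))
sum-mono-< {suc n} f≤g (fsuc i) fᵢ<gᵢ = +-mono-≤-< (f≤g fzero) (sum-mono-< (f≤g ∘ fsuc) i fᵢ<gᵢ)

sum-const-1 : ∀ n → sum {n} (λ _ → 1) ≡ n
sum-const-1 zero    = refl
sum-const-1 (suc n) = cong suc (sum-const-1 n)

blockSum : (Fin n → ℕ) → ℕ → (Fin n → ℕ) → ℕ
blockSum h x e = sum (λ i → if ⌊ h i ≟ x ⌋ then e i else 0)

blockSize : (Fin n → ℕ) → ℕ → ℕ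
blockSize h x = blockSum h x (λ _ → 1)

BlockMonotone : (Fin n → ℕ) → (Fin n → ℕ) → Set
BlockMonotone h e = ∀ i j → toℕ i < toℕ j → h i ≡ h j → e i ≤ e j

laterInBlock : (Fin n → ℕ) → Fin n → ℕ
laterInBlock {suc n} h fzero    = blockSize (h ∘ fsuc) (h fzero)
laterInBlock {suc n} h (fsuc i) = laterInBlock (h ∘ fsuc) i

blockSum-0 : ∀ (h : Fin n → ℕ) x {e} → (∀ i → h i ≡ x → e i ≡ 0) → blockSum h x e ≡ 0
blockSum-0 {zero}  h x e≡0 = refl
blockSum-0 {suc n} h x e≡0 with h fzero ≟ x
... | yes h₀≡x = cong₂ _+_ (e≡0 fzero h₀≡x) (blockSum-0 (h ∘ fsuc) x (e≡0 ∘ fsuc))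
... | no  _    = blockSum-0 (h ∘ fsuc) x (e≡0 ∘ fsuc)

module _ (h : Fin n → ℕ) (x : ℕ) where

  private
    inBlock : ∀ {e e′ : Fin n → ℕ} {R : ℕ → ℕ → Set} → R 0 0 → (∀ i → h i ≡ x → R (e i) (e′ i)) →
              ∀ i → R (if ⌊ h i ≟ x ⌋ then e i else 0) (if ⌊ h i ≟ x ⌋ then e′ i else 0)
    inBlock r00 r i with h i ≟ x
    ... | yes hᵢ≡x = r i hᵢ≡x
    ... | no  _    = r00

  blockSum-mono : {e e′ : Fin n → ℕ} → (∀ i → h i ≡ x → e i ≤ e′ i) →
                  blockSum h x e ≤ blockSum h x e′
  blockSum-mono {e} {e′} e≤e′ = sum-mono-≤ (inBlock {e} {e′} {_≤_} z≤n e≤e′)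

  blockSum-cong : {e e′ : Fin n → ℕ} → (∀ i → h i ≡ x → e i ≡ e′ i) →
                  blockSum h x e ≡ blockSum h x e′
  blockSum-cong {e} {e′} e≡e′ = sum-cong-≗ (inBlock {e} {e′} {_≡_} refl e≡e′)

  blockSum≤blockSize : {e : Fin n → ℕ} → (∀ i → e i ≤ 1) → blockSum h x e ≤ blockSize h x
  blockSum≤blockSize e≤1 = blockSum-mono (λ i _ → e≤1 i)

  blockSum<blockSize⇒∃0 : {e : Fin n → ℕ} → (∀ i → e i ≤ 1) → blockSum h x e < blockSize h x →
                          ∃ λ i → h i ≡ x × e i ≡ 0
  blockSum<blockSize⇒∃0 {e} e≤1 Σ<size with any? (λ i → (h i ≟ x) ×-dec (e i ≟ 0))
  ... | yes found = found
  ... | no  none  = ⊥-elim (<-irrefl (blockSum-cong all-1) Σ<size)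
    where
    all-1 : ∀ i → h i ≡ x → e i ≡ 1
    all-1 i hᵢ≡x with n≤1⇒n≡0∨n≡1 (e≤1 i)
    ... | inj₁ eᵢ≡0 = ⊥-elim (none (i , hᵢ≡x , eᵢ≡0))
    ... | inj₂ eᵢ≡1 = eᵢ≡1

laterInBlock<blockSize : ∀ (h : Fin n → ℕ) i → laterInBlock h i < blockSize h (h i)
laterInBlock<blockSize {suc n} h fzero with h fzero ≟ h fzero
... | yes _    = ≤-refl
... | no h₀≢h₀ = ⊥-elim (h₀≢h₀ refl)
laterInBlock<blockSize {suc n} h (fsuc i) =
  <-≤-trans (laterInBlock<blockSize (h ∘ fsuc) i) (m≤n+m _ _)

laterInBlock-anti : ∀ (h : Fin n → ℕ) i j → toℕ i ≤ toℕ j → h i ≡ h j →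
                    laterInBlock h j ≤ laterInBlock h i
laterInBlock-anti {suc n} h fzero    fzero    _ _ = ≤-refl
laterInBlock-anti {suc n} h fzero    (fsuc j) _ h₀≡hⱼ rewrite h₀≡hⱼ =
  <⇒≤ (laterInBlock<blockSize (h ∘ fsuc) j)
laterInBlock-anti {suc n} h (fsuc i) (fsuc j) (s≤s i≤j) hᵢ≡hⱼ =
  laterInBlock-anti (h ∘ fsuc) i j i≤j hᵢ≡hⱼ

blockSum-suffix : ∀ (h : Fin n → ℕ) x J →
                  blockSum h x (λ i → 𝟙 (laterInBlock h i <? J)) ≡ J ⊓ blockSize h x
blockSum-suffix {zero}  h x J = sym (⊓-zeroʳ J)
blockSum-suffix {suc n} h x J with h fzero ≟ x
... | no  _    = blockSum-suffix (h ∘ fsuc) x J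
... | yes refl = begin
  𝟙 (c <? J) + blockSum (h ∘ fsuc) (h fzero) (λ i → 𝟙 (laterInBlock (h ∘ fsuc) i <? J))
    ≡⟨ cong (𝟙 (c <? J) +_) (blockSum-suffix (h ∘ fsuc) (h fzero) J) ⟩
  𝟙 (c <? J) + J ⊓ c
    ≡⟨ step (c <? J) ⟩
  J ⊓ suc c ∎
  where
  open ≡-Reasoning
  c : ℕ
  c = blockSize (h ∘ fsuc) (h fzero)
  step : (c<J : Dec (c < J)) → 𝟙 c<J + J ⊓ c ≡ J ⊓ suc c
  step (yes c<J) = trans (cong suc (m≥n⇒m⊓n≡n (<⇒≤ c<J))) (sym (m≥n⇒m⊓n≡n c<J))
  step (no  c≮J) = trans (m≤n⇒m⊓n≡m J≤c) (sym (m≤n⇒m⊓n≡m (m≤n⇒m≤1+n J≤c)))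
    where
    J≤c : J ≤ c
    J≤c = ≮⇒≥ c≮J

blockMonotone-1 : ∀ {h e : Fin n → ℕ} → (∀ i → e i ≤ 1) → BlockMonotone h e →
                  ∀ {i j} → toℕ i < toℕ j → h i ≡ h j → e i ≡ 1 → e j ≡ 1
blockMonotone-1 {e = e} e≤1 mono {i} {j} i<j hᵢ≡hⱼ eᵢ≡1 =
  ≤-antisym (e≤1 j) (subst (_≤ e j) eᵢ≡1 (mono i j i<j hᵢ≡hⱼ))

blockMonotone⇒suffix : ∀ (h e : Fin n → ℕ) → (∀ i → e i ≤ 1) → BlockMonotone h e →
                       ∀ i → e i ≡ 𝟙 (laterInBlock h i <? blockSum h (h i) e)
blockMonotone⇒suffix {suc n} h e e≤1 mono fzero with h fzero ≟ h fzero
... | no h₀≢h₀ = ⊥-elim (h₀≢h₀ refl)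
... | yes _ with n≤1⇒n≡0∨n≡1 (e≤1 fzero)
...   | inj₁ e₀≡0 rewrite e₀≡0 =
  sym (𝟙-no (_ <? _) (≤⇒≯ (blockSum≤blockSize (h ∘ fsuc) (h fzero) (e≤1 ∘ fsuc))))
...   | inj₂ e₀≡1 rewrite e₀≡1
                        | blockSum-cong (h ∘ fsuc) (h fzero) {e ∘ fsuc} {λ _ → 1}
                            (λ j hⱼ≡h₀ → blockMonotone-1 e≤1 mono z<s (sym hⱼ≡h₀) e₀≡1) =
  sym (𝟙-yes (_ <? _) ≤-refl)
blockMonotone⇒suffix {suc n} h e e≤1 mono (fsuc i)
  with IH ← blockMonotone⇒suffix (h ∘ fsuc) (e ∘ fsuc) (e≤1 ∘ fsuc)
              (λ j k j<k → mono (fsuc j) (fsuc k) (s≤s j<k)) i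
  with h fzero ≟ h (fsuc i) | n≤1⇒n≡0∨n≡1 (e≤1 fzero)
... | no  _     | _         = IH
... | yes _     | inj₁ e₀≡0 rewrite e₀≡0 = IH
... | yes h₀≡hᵢ | inj₂ e₀≡1 rewrite e₀≡1 =
  trans eᵢ≡1 (sym (𝟙-yes (_ <? _) (m<n⇒m<1+n (𝟙≡1⇒ (_ <? _) (trans (sym IH) eᵢ≡1)))))
  where
  eᵢ≡1 : e (fsuc i) ≡ 1
  eᵢ≡1 = blockMonotone-1 e≤1 mono z<s h₀≡hᵢ e₀≡1

≤1-cases : ∀ {a b} → a ≤ b → b ≤ 1 → a ≡ b ⊎ (a ≡ 0 × b ≡ 1)
≤1-cases z≤n       z≤n       = inj₁ refl
≤1-cases z≤n       (s≤s z≤n) = inj₂ (refl , refl)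
≤1-cases (s≤s z≤n) (s≤s z≤n) = inj₁ refl

+≤1⇒≤suc : ∀ a {b} → b ≤ 1 → a + b ≤ suc a
+≤1⇒≤suc a b≤1 = ≤-trans (+-monoʳ-≤ a b≤1) (≤-reflexive (+-comm a 1))

≤suc⇒pred≤ : ∀ {m k} → m ≤ suc k → pred m ≤ k
≤suc⇒pred≤ {zero}  _         = z≤n
≤suc⇒pred≤ {suc m} (s≤s m≤k) = m≤k

pred≤⇒≤suc : ∀ {m k} → pred m ≤ k → m ≤ suc k
pred≤⇒≤suc {zero}  _   = z≤n
pred≤⇒≤suc {suc m} m≤k = s≤s m≤k

m≤1+n⇒m∸n≤1 : ∀ {m k} → m ≤ suc k → m ∸ k ≤ 1
m≤1+n⇒m∸n≤1 {m} {k} m≤1+k = m≤n+o⇒m∸n≤o m k (subst (m ≤_) (+-comm 1 k) m≤1+k)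

chain-split : ∀ a b c → c ≤ a + b + 1 → 𝟙 (a <? c) + c ⊓ a + (c ∸ suc a) ⊓ b ≡ c
chain-split a b c c≤ with a <? c
... | no  a≮c = begin
  c ⊓ a + (c ∸ suc a) ⊓ b ≡⟨ cong₂ _+_ (m≤n⇒m⊓n≡m c≤a) (cong (_⊓ b) rest≡0) ⟩
  c + 0                   ≡⟨ +-identityʳ c ⟩
  c                       ∎
  where
  open ≡-Reasoning
  c≤a : c ≤ a
  c≤a = ≮⇒≥ a≮c
  rest≡0 : c ∸ suc a ≡ 0
  rest≡0 = m≤n⇒m∸n≡0 (m≤n⇒m≤1+n c≤a)
... | yes a<c = begin
  suc (c ⊓ a + (c ∸ suc a) ⊓ b) ≡⟨ cong₂ (λ x y → suc (x + y)) (m≥n⇒m⊓n≡n (<⇒≤ a<c))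
                                                              (m≤n⇒m⊓n≡m rest≤b) ⟩
  suc a + (c ∸ suc a)           ≡⟨ m+[n∸m]≡n a<c ⟩
  c                             ∎
  where
  open ≡-Reasoning
  rest≤b : c ∸ suc a ≤ b
  rest≤b = m≤n+o⇒m∸n≤o c (suc a) (subst (c ≤_) (+-comm (a + b) 1) c≤)

rep-cancel : ∀ x {p d p′ d′} → p ≡ x + d → p′ ≡ x + d′ → p ≤ p′ → d ≤ d′
rep-cancel x E E′ le = +-cancelˡ-≤ x _ _ (subst₂ _≤_ E E′ le)

rep-uncancel : ∀ x {p d p′ d′} → p ≡ x + d → p′ ≡ x + d′ → d ≤ d′ → p ≤ p′
rep-uncancel x E E′ le = subst₂ _≤_ (sym E) (sym E′) (+-monoʳ-≤ x le)

rep-uncancel-suc : ∀ x {p d p′ d′} → p ≡ x + d → p′ ≡ x + d′ → d′ ≤ suc d → p′ ≤ suc p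
rep-uncancel-suc x {d = d} E E′ le =
  subst₂ _≤_ (sym E′) (cong suc (sym E)) (≤-trans (+-monoʳ-≤ x le) (≤-reflexive (+-suc x d)))

All⇒AllPairs : {P : A → Set} {R : A → A → Set} → (∀ {x y} → P x → P y → R x y) →
               ∀ {xs} → All P xs → AllPairs R xs
All⇒AllPairs r []         = []
All⇒AllPairs r (px ∷ pxs) = All.map (r px) pxs ∷ All⇒AllPairs r pxs

AllPairs⇒∈ : {R : A → A → Set} → Reflexive R → Symmetric R →
             ∀ {xs} → AllPairs R xs → ∀ {x y} → x ∈ xs → y ∈ xs → R x y
AllPairs⇒∈ r-refl r-sym (_  ∷ _)   (here refl) (here refl) = r-refl
AllPairs⇒∈ r-refl r-sym (rx ∷ _)   (here refl) (there y∈)  = All.lookup rx y∈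
AllPairs⇒∈ r-refl r-sym (rx ∷ _)   (there x∈)  (here refl) = r-sym (All.lookup rx x∈)
AllPairs⇒∈ r-refl r-sym (_  ∷ rxs) (there x∈)  (there y∈)  = AllPairs⇒∈ r-refl r-sym rxs x∈ y∈

AllPairs-mapWith : {P : A → Set} {R R′ : A → A → Set} →
                   (∀ {x y} → P x → P y → R x y → R′ x y) →
                   ∀ {xs} → All P xs → AllPairs R xs → AllPairs R′ xs
AllPairs-mapWith r⇒r′ []         []         = []
AllPairs-mapWith r⇒r′ (px ∷ pxs) (rx ∷ rxs) =
  All.zipWith (λ (py , rxy) → r⇒r′ px py rxy) (pxs , rx) ∷ AllPairs-mapWith r⇒r′ pxs rxs

sum-map-mono-≤ : ∀ (f g : A → ℕ) {xs} → All (λ x → f x ≤ g x) xs →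
                 List.sum (map f xs) ≤ List.sum (map g xs)
sum-map-mono-≤ f g []           = z≤n
sum-map-mono-≤ f g (fx≤gx ∷ ps) = +-mono-≤ fx≤gx (sum-map-mono-≤ f g ps)

sum-map-mono-< : ∀ (f g : A → ℕ) {xs x} → All (λ x → f x ≤ g x) xs → x ∈ xs → f x < g x →
                 List.sum (map f xs) < List.sum (map g xs)
sum-map-mono-< f g (_     ∷ ps) (here refl) fx<gx = +-mono-<-≤ fx<gx (sum-map-mono-≤ f g ps)
sum-map-mono-< f g (fy≤gy ∷ ps) (there x∈)  fx<gx = +-mono-≤-< fy≤gy (sum-map-mono-< f g ps x∈ fx<gx)

map≡replicate : {f : A → B} {y : B} {xs : List A} → All (λ x → f x ≡ y) xs →
                map f xs ≡ replicate (length xs) y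
map≡replicate []             = refl
map≡replicate (fx≡y ∷ fxs≡y) = cong₂ _∷_ fx≡y (map≡replicate fxs≡y)

lookup-ext : {w w′ : Vec A n} → (∀ i → lookup w i ≡ lookup w′ i) → w ≡ w′
lookup-ext {w = w} {w′} eq =
  trans (sym (tabulate∘lookup w)) (trans (tabulate-cong eq) (tabulate∘lookup w′))

lookupAssoc : List ℕ → List ℕ → ℕ → ℕ
lookupAssoc []       _        _ = 0
lookupAssoc (_ ∷ _)  []       _ = 0
lookupAssoc (k ∷ ks) (c ∷ cs) x = if ⌊ x ≟ k ⌋ then c else lookupAssoc ks cs x

module _ (k : ℕ) (ks : List ℕ) (c : ℕ) (cs : List ℕ) where

  lookupAssoc-here : lookupAssoc (k ∷ ks) (c ∷ cs) k ≡ c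
  lookupAssoc-here with k ≟ k
  ... | yes _  = refl
  ... | no k≢k = ⊥-elim (k≢k refl)

  lookupAssoc-there : ∀ {x} → x ≢ k → lookupAssoc (k ∷ ks) (c ∷ cs) x ≡ lookupAssoc ks cs x
  lookupAssoc-there {x} x≢k with x ≟ k
  ... | yes x≡k = ⊥-elim (x≢k x≡k)
  ... | no  _   = refl

lookupAssoc-map : ∀ (F : ℕ → ℕ) {ks x} → x ∈ ks → lookupAssoc ks (map F ks) x ≡ F x
lookupAssoc-map F {k ∷ ks} {x} x∈ with x ≟ k | x∈
... | yes refl | _          = refl
... | no  x≢k  | here x≡k   = ⊥-elim (x≢k x≡k)
... | no  _    | there x∈ks = lookupAssoc-map F x∈ks

lookupAssoc-mono : ∀ ks {cs cs′} x → Pointwise _≤_ cs cs′ →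
                   lookupAssoc ks cs x ≤ lookupAssoc ks cs′ x
lookupAssoc-mono []       x _              = z≤n
lookupAssoc-mono (k ∷ ks) x []             = z≤n
lookupAssoc-mono (k ∷ ks) x (c≤c′ ∷ cs≤cs′) with x ≟ k
... | yes _ = c≤c′
... | no  _ = lookupAssoc-mono ks x cs≤cs′

lookupAssoc-replicate-0 : ∀ ks m x → lookupAssoc ks (replicate m 0) x ≡ 0
lookupAssoc-replicate-0 []       m       x = refl
lookupAssoc-replicate-0 (k ∷ ks) zero    x = refl
lookupAssoc-replicate-0 (k ∷ ks) (suc m) x with x ≟ k
... | yes _ = refl
... | no  _ = lookupAssoc-replicate-0 ks m x

module _ (F : ℕ → ℕ) where

  map-lookupAssoc-⊓ : ∀ {ks cs} → AllPairs _≢_ ks → Pointwise _≤_ cs (map F ks) →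
                      map (λ x → lookupAssoc ks cs x ⊓ F x) ks ≡ cs
  map-lookupAssoc-⊓ {[]}     {[]}     []           []           = refl
  map-lookupAssoc-⊓ {k ∷ ks} {c ∷ cs} (k≢ks ∷ ks!) (c≤Fk ∷ cs≤) = cong₂ _∷_
    (trans (cong (_⊓ F k) (lookupAssoc-here k ks c cs)) (m≤n⇒m⊓n≡m c≤Fk))
    (trans (map-cong-local (All.map (λ k≢x → cong (_⊓ F _) (lookupAssoc-there k ks c cs (k≢x ∘ sym)))
                                    k≢ks))
           (map-lookupAssoc-⊓ ks! cs≤))

  lookupAssoc-< : ∀ {ks cs} → AllPairs _≢_ ks → Pointwise _≤_ cs (map F ks) → cs ≢ map F ks →
                  ∃ λ x → x ∈ ks × lookupAssoc ks cs x < F x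
  lookupAssoc-< {[]}     {[]}     []           []           cs≢ = ⊥-elim (cs≢ refl)
  lookupAssoc-< {k ∷ ks} {c ∷ cs} (k≢ks ∷ ks!) (c≤Fk ∷ cs≤) cs≢ with m≤n⇒m<n∨m≡n c≤Fk
  ... | inj₁ c<Fk = k , here refl , subst (_< F k) (sym (lookupAssoc-here k ks c cs)) c<Fk
  ... | inj₂ c≡Fk with lookupAssoc-< ks! cs≤ (cs≢ ∘ cong₂ _∷_ c≡Fk)
  ...   | x , x∈ks , lookup<Fx = x , there x∈ks ,
    subst (_< F x) (sym (lookupAssoc-there k ks c cs (All.lookup k≢ks x∈ks ∘ sym))) lookup<Fx

-- Ranks and permutations

injective⇒surjective : (f : Fin n → Fin n) → Injective _≡_ _≡_ f → ∀ y → ∃ λ x → f x ≡ y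
injective⇒surjective {suc n} f f-inj y with any? (λ x → f x ≟ᶠ y)
... | yes found = found
... | no  none  = ⊥-elim (1+n≰n (injective⇒≤ {f = f′} f′-inj))
  where
  missed : ∀ x → y ≢ f x
  missed x y≡fx = none (x , sym y≡fx)
  f′ : Fin (suc n) → Fin n
  f′ x = punchOut (missed x)
  f′-inj : Injective _≡_ _≡_ f′
  f′-inj {x} {x′} eq = f-inj (punchOut-injective (missed x) (missed x′) eq)

fromInjection : (f : Fin n → Fin n) → Injective _≡_ _≡_ f → Permutation′ n
fromInjection {n} f f-inj = permutation f⁻¹ f (λ y → f-inj (proj₂ (onto (f y)))) (proj₂ ∘ onto)
  where
  onto : ∀ y → ∃ λ x → f x ≡ y
  onto = injective⇒surjective f f-inj
  f⁻¹ : Fin n → Fin n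
  f⁻¹ = proj₁ ∘ onto

module Rank {_≺_ : Fin n → Fin n → Set} (_≺?_ : ∀ i j → Dec (i ≺ j)) (≺-trans : Transitive _≺_)
            (≺-irrefl : ∀ {i} → ¬ i ≺ i) (≺-connex : ∀ {i j} → i ≢ j → i ≺ j ⊎ j ≺ i) where

  rank : Fin n → ℕ
  rank i = sum (λ k → 𝟙 (k ≺? i))

  private
    𝟙[i≺i]<1 : ∀ i → 𝟙 (i ≺? i) < 1
    𝟙[i≺i]<1 i rewrite 𝟙-no (i ≺? i) ≺-irrefl = z<s

  rank-mono : ∀ {i j} → i ≺ j → rank i < rank j
  rank-mono {i} {j} i≺j =
    sum-mono-< (λ k → 𝟙-mono (k ≺? i) (k ≺? j) (λ k≺i → ≺-trans k≺i i≺j)) i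
               (subst (𝟙 (i ≺? i) <_) (sym (𝟙-yes (i ≺? j) i≺j)) (𝟙[i≺i]<1 i))

  rank<n : ∀ i → rank i < n
  rank<n i = subst (rank i <_) (sum-const-1 n) (sum-mono-< (λ k → 𝟙≤1 (k ≺? i)) i (𝟙[i≺i]<1 i))

  rank-injective : ∀ {i j} → rank i ≡ rank j → i ≡ j
  rank-injective {i} {j} eq with i ≟ᶠ j
  ... | yes i≡j = i≡j
  ... | no  i≢j with ≺-connex i≢j
  ...   | inj₁ i≺j = ⊥-elim (<-irrefl eq (rank-mono i≺j))
  ...   | inj₂ j≺i = ⊥-elim (<-irrefl (sym eq) (rank-mono j≺i))

  upSet⇒threshold : ∀ (e : Fin n → ℕ) → (∀ i → e i ≤ 1) →
                    (∀ {i j} → i ≺ j → e i ≡ 1 → e j ≡ 1) →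
                    ∀ i → e i ≡ 𝟙 (sum (λ j → 1 ∸ e j) ≤? rank i)
  upSet⇒threshold e e≤1 up i with n≤1⇒n≡0∨n≡1 (e≤1 i)
  ... | inj₂ eᵢ≡1 = trans eᵢ≡1 (sym (𝟙-yes (_ ≤? _) (sum-mono-≤ zero⇒≺i)))
    where
    zero⇒≺i : ∀ j → 1 ∸ e j ≤ 𝟙 (j ≺? i)
    zero⇒≺i j with n≤1⇒n≡0∨n≡1 (e≤1 j)
    ... | inj₂ eⱼ≡1 rewrite eⱼ≡1 = z≤n
    ... | inj₁ eⱼ≡0 with j ≟ᶠ i
    ...   | yes refl = ⊥-elim (0≢1+n (trans (sym eⱼ≡0) eᵢ≡1))
    ...   | no  j≢i with ≺-connex j≢i
    ...     | inj₁ j≺i rewrite eⱼ≡0 | 𝟙-yes (j ≺? i) j≺i = ≤-refl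
    ...     | inj₂ i≺j = ⊥-elim (0≢1+n (trans (sym eⱼ≡0) (up i≺j eᵢ≡1)))
  ... | inj₁ eᵢ≡0 = trans eᵢ≡0 (sym (𝟙-no (_ ≤? _) (<⇒≱ (sum-mono-< ≺i⇒zero i strict))))
    where
    ≺i⇒zero : ∀ j → 𝟙 (j ≺? i) ≤ 1 ∸ e j
    ≺i⇒zero j with j ≺? i
    ... | no  _   = z≤n
    ... | yes j≺i with n≤1⇒n≡0∨n≡1 (e≤1 j)
    ...   | inj₁ eⱼ≡0 rewrite eⱼ≡0 = ≤-refl
    ...   | inj₂ eⱼ≡1 = ⊥-elim (0≢1+n (trans (sym eᵢ≡0) (up j≺i eⱼ≡1)))
    strict : 𝟙 (i ≺? i) < 1 ∸ e i
    strict rewrite eᵢ≡0 = 𝟙[i≺i]<1 i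

module KeyOrder (key : Fin n → ℕ) where

  _≺_ : Fin n → Fin n → Set
  i ≺ j = key i < key j ⊎ (key i ≡ key j × toℕ i < toℕ j)

  _≺?_ : ∀ i j → Dec (i ≺ j)
  i ≺? j = (key i <? key j) ⊎-dec ((key i ≟ key j) ×-dec (toℕ i <? toℕ j))

  ≺⇒key≤ : ∀ {i j} → i ≺ j → key i ≤ key j
  ≺⇒key≤ (inj₁ keyᵢ<keyⱼ)       = <⇒≤ keyᵢ<keyⱼ
  ≺⇒key≤ (inj₂ (keyᵢ≡keyⱼ , _)) = ≤-reflexive keyᵢ≡keyⱼ

  ≺-trans : Transitive _≺_
  ≺-trans (inj₁ a<b)         (inj₁ b<c)         = inj₁ (<-trans a<b b<c)
  ≺-trans (inj₁ a<b)         (inj₂ (b≡c , _))   = inj₁ (<-≤-trans a<b (≤-reflexive b≡c))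
  ≺-trans (inj₂ (a≡b , _))   (inj₁ b<c)         = inj₁ (≤-<-trans (≤-reflexive a≡b) b<c)
  ≺-trans (inj₂ (a≡b , i<j)) (inj₂ (b≡c , j<k)) = inj₂ (trans a≡b b≡c , <-trans i<j j<k)

  ≺-irrefl : ∀ {i} → ¬ i ≺ i
  ≺-irrefl (inj₁ a<a)       = <-irrefl refl a<a
  ≺-irrefl (inj₂ (_ , i<i)) = <-irrefl refl i<i

  ≺-connex : ∀ {i j} → i ≢ j → i ≺ j ⊎ j ≺ i
  ≺-connex {i} {j} i≢j with <-cmp (key i) (key j)
  ... | tri< a<b _ _ = inj₁ (inj₁ a<b)
  ... | tri> _ _ b<a = inj₂ (inj₁ b<a)
  ... | tri≈ _ a≡b _ with <-cmp (toℕ i) (toℕ j)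
  ...   | tri< i<j _ _ = inj₁ (inj₂ (a≡b , i<j))
  ...   | tri≈ _ i≡j _ = ⊥-elim (i≢j (toℕ-injective i≡j))
  ...   | tri> _ _ j<i = inj₂ (inj₂ (sym a≡b , j<i))

-- Faces of T

record _⊑_ (w w′ : Vec ℕ n) : Set where
  constructor mk⊑
  field
    ⊑-below  : ∀ i → lookup w i ≤ lookup w′ i
    ⊑-within : ∀ i → lookup w′ i ≤ suc (lookup w i)
open _⊑_ public

_⊑?_ : (w w′ : Vec ℕ n) → Dec (w ⊑ w′)
w ⊑? w′ = map′ (λ p → mk⊑ (proj₁ ∘ p) (proj₂ ∘ p))
               (λ w⊑w′ i → ⊑-below w⊑w′ i , ⊑-within w⊑w′ i)
               (all? λ i → (lookup w i ≤? lookup w′ i) ×-dec (lookup w′ i ≤? suc (lookup w i)))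

⊑-refl : {w : Vec ℕ n} → w ⊑ w
⊑-refl = mk⊑ (λ _ → ≤-refl) (λ _ → n≤1+n _)

⊑-antisym : {w w′ : Vec ℕ n} → w ⊑ w′ → w′ ⊑ w → w ≡ w′
⊑-antisym w⊑w′ w′⊑w = lookup-ext λ i → ≤-antisym (⊑-below w⊑w′ i) (⊑-below w′⊑w i)

Comparable : Vec ℕ n → Vec ℕ n → Set
Comparable w w′ = w ⊑ w′ ⊎ w′ ⊑ w

Comparable-refl : {w : Vec ℕ n} → Comparable w w
Comparable-refl = inj₁ ⊑-refl

Comparable-sym : {w w′ : Vec ℕ n} → Comparable w w′ → Comparable w′ w
Comparable-sym = swap

Comparable⇒≤suc : {w w′ : Vec ℕ n} → Comparable w w′ → ∀ i → lookup w i ≤ suc (lookup w′ i)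
Comparable⇒≤suc (inj₁ w⊑w′) i = m≤n⇒m≤1+n (⊑-below w⊑w′ i)
Comparable⇒≤suc (inj₂ w′⊑w) i = ⊑-within w′⊑w i

lookup-vert : ∀ (u : Vec ℕ n) π t i →
              lookup (vert u π t) i ≡ lookup u i + 𝟙 (toℕ t ≤? toℕ (π ⟨$⟩ˡ i))
lookup-vert u π t i = lookup∘tabulate _ i

vert-⊑ : ∀ (u : Vec ℕ n) π {t t′} → toℕ t′ ≤ toℕ t → vert u π t ⊑ vert u π t′
vert-⊑ u π {t} {t′} t′≤t = mk⊑ below within
  where
  below : ∀ i → lookup (vert u π t) i ≤ lookup (vert u π t′) i
  below i rewrite lookup-vert u π t i | lookup-vert u π t′ i =
    +-monoʳ-≤ (lookup u i) (𝟙-mono (_ ≤? _) (_ ≤? _) (≤-trans t′≤t))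
  within : ∀ i → lookup (vert u π t′) i ≤ suc (lookup (vert u π t) i)
  within i rewrite lookup-vert u π t i | lookup-vert u π t′ i =
    ≤-trans (+≤1⇒≤suc (lookup u i) (𝟙≤1 _)) (s≤s (m≤m+n (lookup u i) _))

T-face⇒ : ∀ {q} {σ : List (Vec ℕ n)} → T n q σ → All (InW q) σ × AllPairs Comparable σ
T-face⇒ (u , π , (_ , _ , vert∈W) , σ⊆F) =
  All.map (λ { (t , refl) → vert∈W t }) σ⊆F , All⇒AllPairs comparable σ⊆F
  where
  comparable : ∀ {w w′} → ∃ (λ t → w ≡ vert u π t) → ∃ (λ t → w′ ≡ vert u π t) →
               Comparable w w′
  comparable (t , refl) (t′ , refl) with ≤-total (toℕ t′) (toℕ t)
  ... | inj₁ t′≤t = inj₁ (vert-⊑ u π t′≤t)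
  ... | inj₂ t≤t′ = inj₂ (vert-⊑ u π t≤t′)

-- σ lies in the facet F(low, π): every w ∈ σ is low plus a 0/1 vector (its excess), the
-- excesses are nested, and π lists the coordinates by how many of them are 1 there.  The
-- minimum is capped at q so that low + 𝟏 still lies in W.
module FacetThrough {q : ℕ} {v : Vec ℕ n} {τ : List (Vec ℕ n)}
                    (σ⊆W : All (InW (suc q)) (v ∷ τ)) (σ-comparable : AllPairs Comparable (v ∷ τ)) where

  σ : List (Vec ℕ n)
  σ = v ∷ τ

  sorted : ∀ {w} → w ∈ σ → ∀ i j → toℕ i ≤ toℕ j → lookup w i ≤ lookup w j
  sorted w∈σ = proj₁ (All.lookup σ⊆W w∈σ)

  comparable : ∀ {w w′} → w ∈ σ → w′ ∈ σ → Comparable w w′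
  comparable = AllPairs⇒∈ Comparable-refl Comparable-sym σ-comparable

  -- Abstract so that min is never unfolded: only these four facts about low are used.
  abstract
    low : Fin n → ℕ
    low i = min q (map (λ w → lookup w i) σ)

    low≤q : ∀ i → low i ≤ q
    low≤q i = min≤⊤ q (map (λ w → lookup w i) σ)

    low≤ : ∀ {w} → w ∈ σ → ∀ i → low i ≤ lookup w i
    low≤ w∈σ i = All.lookup (All.map⁻ (min≤xs q (map (λ w → lookup w i) σ))) w∈σ

    ≤suc-low : ∀ {w} → w ∈ σ → ∀ i → lookup w i ≤ suc (low i)
    ≤suc-low {w} w∈σ i = pred≤⇒≤suc (v≤min⁺ (≤suc⇒pred≤ (proj₂ (All.lookup σ⊆W w∈σ) i))
      (All.map⁺ (All.tabulate λ w′∈σ →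
        ≤suc⇒pred≤ (Comparable⇒≤suc (comparable w∈σ w′∈σ) i))))

    low-sorted : ∀ i j → toℕ i ≤ toℕ j → low i ≤ low j
    low-sorted i j i≤j = v≤min⁺ (min≤⊤ q (map (λ w → lookup w i) σ))
      (All.map⁺ (All.tabulate λ w∈σ → ≤-trans (low≤ w∈σ i) (sorted w∈σ i j i≤j)))

  excess : Vec ℕ n → Fin n → ℕ
  excess w i = lookup w i ∸ low i

  excess≤1 : ∀ {w} → w ∈ σ → ∀ i → excess w i ≤ 1
  excess≤1 w∈σ i = m≤1+n⇒m∸n≤1 (≤suc-low w∈σ i)

  excess-nested : ∀ {w w′} → w ∈ σ → w′ ∈ σ →
                  (∀ i → excess w i ≤ excess w′ i) ⊎ (∀ i → excess w′ i ≤ excess w i)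
  excess-nested w∈σ w′∈σ with comparable w∈σ w′∈σ
  ... | inj₁ w⊑w′ = inj₁ λ i → ∸-monoˡ-≤ (low i) (⊑-below w⊑w′ i)
  ... | inj₂ w′⊑w = inj₂ λ i → ∸-monoˡ-≤ (low i) (⊑-below w′⊑w i)

  key : Fin n → ℕ
  key i = List.sum (map (λ w → excess w i) σ)

  key-sorted : ∀ i j → toℕ i ≤ toℕ j → low i ≡ low j → key i ≤ key j
  key-sorted i j i≤j lowᵢ≡lowⱼ = sum-map-mono-≤ _ _ (All.tabulate λ {w} w∈σ →
    subst (λ l → lookup w i ∸ low i ≤ lookup w j ∸ l) lowᵢ≡lowⱼ
          (∸-monoˡ-≤ (low i) (sorted w∈σ i j i≤j)))

  excess-upClosed : ∀ {w} → w ∈ σ → ∀ {i j} → key i ≤ key j → excess w i ≡ 1 → excess w j ≡ 1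
  excess-upClosed {w} w∈σ {i} {j} keyᵢ≤keyⱼ eᵢ≡1 with n≤1⇒n≡0∨n≡1 (excess≤1 w∈σ j)
  ... | inj₂ eⱼ≡1 = eⱼ≡1
  ... | inj₁ eⱼ≡0 = ⊥-elim (<⇒≱ keyⱼ<keyᵢ keyᵢ≤keyⱼ)
    where
    j≤i : ∀ {w′} → w′ ∈ σ → excess w′ j ≤ excess w′ i
    j≤i {w′} w′∈σ with excess-nested w∈σ w′∈σ
    ... | inj₁ w≤w′ = ≤-trans (excess≤1 w′∈σ j) (subst (_≤ excess w′ i) eᵢ≡1 (w≤w′ i))
    ... | inj₂ w′≤w = ≤-trans (w′≤w j) (subst (_≤ excess w′ i) (sym eⱼ≡0) z≤n)
    keyⱼ<keyᵢ : key j < key i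
    keyⱼ<keyᵢ = sum-map-mono-< (λ w′ → excess w′ j) (λ w′ → excess w′ i)
                               (All.tabulate j≤i) w∈σ (subst₂ _<_ (sym eⱼ≡0) (sym eᵢ≡1) z<s)

  open KeyOrder key
  open Rank _≺?_ ≺-trans ≺-irrefl ≺-connex

  rankFin : Fin n → Fin n
  rankFin i = fromℕ< (rank<n i)

  toℕ-rankFin : ∀ i → toℕ (rankFin i) ≡ rank i
  toℕ-rankFin i = toℕ-fromℕ< (rank<n i)

  rankFin-injective : Injective _≡_ _≡_ rankFin
  rankFin-injective {i} {j} eq =
    rank-injective (trans (sym (toℕ-rankFin i)) (trans (cong toℕ eq) (toℕ-rankFin j)))

  base : Vec ℕ n
  base = tabulate low

  π : Permutation′ n
  π = fromInjection rankFin rankFin-injective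

  lookup-facet : ∀ t i → lookup (vert base π t) i ≡ low i + 𝟙 (toℕ t ≤? rank i)
  lookup-facet t i = trans (lookup-vert base π t i)
    (cong₂ (λ l r → l + 𝟙 (toℕ t ≤? r)) (lookup∘tabulate low i) (toℕ-rankFin i))

  sameLow⇒rank< : ∀ i j → toℕ i < toℕ j → low i ≡ low j → rank i < rank j
  sameLow⇒rank< i j i<j lowᵢ≡lowⱼ with m≤n⇒m<n∨m≡n (key-sorted i j (<⇒≤ i<j) lowᵢ≡lowⱼ)
  ... | inj₁ keyᵢ<keyⱼ = rank-mono (inj₁ keyᵢ<keyⱼ)
  ... | inj₂ keyᵢ≡keyⱼ = rank-mono (inj₂ (keyᵢ≡keyⱼ , i<j))

  base∈W : InW (suc q) base
  base∈W = (λ i j i≤j → subst₂ _≤_ (sym (lookup∘tabulate low i)) (sym (lookup∘tabulate low j))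
                                   (low-sorted i j i≤j))
         , (λ i → subst (_≤ suc q) (sym (lookup∘tabulate low i)) (m≤n⇒m≤1+n (low≤q i)))

  consistent : Consistent base π
  consistent i j j≡1+i baseᵢ≡baseⱼ = subst₂ _<_ (sym (toℕ-rankFin i)) (sym (toℕ-rankFin j))
    (sameLow⇒rank< i j (≤-reflexive (sym j≡1+i))
      (trans (sym (lookup∘tabulate low i)) (trans baseᵢ≡baseⱼ (lookup∘tabulate low j))))

  facet⊆W : ∀ t → InW (suc q) (vert base π t)
  facet⊆W t = vertex-sorted , vertex-bounded
    where
    vertex-sorted : ∀ i j → toℕ i ≤ toℕ j → lookup (vert base π t) i ≤ lookup (vert base π t) j
    vertex-sorted i j i≤j rewrite lookup-facet t i | lookup-facet t j
      with m≤n⇒m<n∨m≡n (low-sorted i j i≤j)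
    ... | inj₁ lowᵢ<lowⱼ =
      ≤-trans (+≤1⇒≤suc (low i) (𝟙≤1 _)) (≤-trans lowᵢ<lowⱼ (m≤m+n (low j) _))
    ... | inj₂ lowᵢ≡lowⱼ with m≤n⇒m<n∨m≡n i≤j
    ...   | inj₁ i<j = +-mono-≤ (≤-reflexive lowᵢ≡lowⱼ) (𝟙-mono (_ ≤? _) (_ ≤? _)
                         (λ t≤rᵢ → ≤-trans t≤rᵢ (<⇒≤ (sameLow⇒rank< i j i<j lowᵢ≡lowⱼ))))
    ...   | inj₂ i≡j rewrite toℕ-injective i≡j = ≤-refl
    vertex-bounded : ∀ i → lookup (vert base π t) i ≤ suc q
    vertex-bounded i rewrite lookup-facet t i =
      ≤-trans (+-mono-≤ (low≤q i) (𝟙≤1 _)) (≤-reflexive (+-comm q 1))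

  σ⊆facet : ∀ {w} → w ∈ σ → ∃ λ t → w ≡ vert base π t
  σ⊆facet {w} w∈σ = t , lookup-ext entries
    where
    zeros : ℕ
    zeros = sum (λ j → 1 ∸ excess w j)
    zeros≤n : zeros ≤ n
    zeros≤n = subst (zeros ≤_) (sum-const-1 n) (sum-mono-≤ (λ j → m∸n≤m 1 (excess w j)))
    t : Fin (suc n)
    t = fromℕ< (s≤s zeros≤n)
    entries : ∀ i → lookup w i ≡ lookup (vert base π t) i
    entries i = begin
      lookup w i                  ≡⟨ m+[n∸m]≡n (low≤ w∈σ i) ⟨
      low i + excess w i          ≡⟨ cong (low i +_) (upSet⇒threshold (excess w) (excess≤1 w∈σ)
                                       (λ i≺j → excess-upClosed w∈σ (≺⇒key≤ i≺j)) i) ⟩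
      low i + 𝟙 (zeros ≤? rank i) ≡⟨ cong (λ z → low i + 𝟙 (z ≤? rank i))
                                          (toℕ-fromℕ< (s≤s zeros≤n)) ⟨
      low i + 𝟙 (toℕ t ≤? rank i) ≡⟨ lookup-facet t i ⟨
      lookup (vert base π t) i    ∎
      where open ≡-Reasoning

  facet : T n (suc q) σ
  facet = base , π , (base∈W , consistent , facet⊆W) , All.tabulate σ⊆facet

T-face⇐ : ∀ {q} {v : Vec ℕ n} {τ} → All (InW (suc q)) (v ∷ τ) → AllPairs Comparable (v ∷ τ) →
          T n (suc q) (v ∷ τ)
T-face⇐ = FacetThrough.facet

-- Clique complexes

Clique : (A → Set) → (A → A → Set) → Complex A
Clique P R τ = All P τ × AllPairs R τ

record GraphIso (P : A → Set) (R : A → A → Set) (Q : B → Set) (S : B → B → Set) : Set where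
  field
    to          : A → B
    from        : B → A
    to-vertex   : ∀ {a} → P a → Q (to a)
    from-vertex : ∀ {b} → Q b → P (from b)
    from∘to     : ∀ {a} → P a → from (to a) ≡ a
    to∘from     : ∀ {b} → Q b → to (from b) ≡ b
    edge⇔       : ∀ {a a′} → P a → P a′ → R a a′ ⇔ S (to a) (to a′)

module _ {P : A → Set} {R : A → A → Set} where

  Clique-vertex⁻ : ∀ {a} → IsVertex (Clique P R) a → P a
  Clique-vertex⁻ (pa ∷ [] , _) = pa

  Clique-vertex⁺ : ∀ {a} → P a → IsVertex (Clique P R) a
  Clique-vertex⁺ pa = pa ∷ [] , [] ∷ []

clique-≅ : {P : A → Set} {R : A → A → Set} {Q : B → Set} {S : B → B → Set} →
           GraphIso P R Q S → Clique P R ≅ Clique Q S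
clique-≅ {P = P} {R} {Q} {S} iso = record
  { f      = to
  ; g      = from
  ; f-vert = λ _ → Clique-vertex⁺ ∘ to-vertex ∘ Clique-vertex⁻
  ; g-vert = λ _ → Clique-vertex⁺ ∘ from-vertex ∘ Clique-vertex⁻
  ; gf     = λ _ → from∘to ∘ Clique-vertex⁻
  ; fg     = λ _ → to∘from ∘ Clique-vertex⁻
  ; faces  = λ τ τ-vertices → mk⇔ to-face (from-face (All.map Clique-vertex⁻ τ-vertices))
  }
  where
  open GraphIso iso
  to-face : ∀ {τ} → Clique P R τ → Clique Q S (map to τ)
  to-face (pτ , rτ) =
    All.map⁺ (All.map to-vertex pτ) ,
    AllPairs.map⁺ (AllPairs-mapWith (λ pa pa′ → Equivalence.to (edge⇔ pa pa′)) pτ rτ)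
  from-face : ∀ {τ} → All P τ → Clique Q S (map to τ) → Clique P R τ
  from-face pτ (_ , sτ) =
    pτ , AllPairs-mapWith (λ pa pa′ → Equivalence.from (edge⇔ pa pa′)) pτ (AllPairs.map⁻ sτ)

≅-cong-⇔ : {K K′ : Complex A} {L : Complex B} → (∀ τ → K τ ⇔ K′ τ) → K′ ≅ L → K ≅ L
≅-cong-⇔ {K = K} {K′} K⇔K′ iso = record
  { f      = f
  ; g      = g
  ; f-vert = λ a → f-vert a ∘ to′
  ; g-vert = λ b → from′ ∘ g-vert b
  ; gf     = λ a → gf a ∘ to′
  ; fg     = fg
  ; faces  = λ τ τ-vertices → ⇔-trans (K⇔K′ τ) (faces τ (All.map to′ τ-vertices))
  }
  where
  open _≅_ iso
  to′ : ∀ {τ} → K τ → K′ τ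
  to′ {τ} = Equivalence.to (K⇔K′ τ)
  from′ : ∀ {τ} → K′ τ → K τ
  from′ {τ} = Equivalence.from (K⇔K′ τ)

LinkVertex : ℕ → Vec ℕ n → Vec ℕ n → Set
LinkVertex q v w = v ≢ w × InW q w × Comparable v w

link-T⇔ : ∀ {q} {v : Vec ℕ n} → InW (suc q) v → ∀ τ →
          link (T n (suc q)) v τ ⇔ Clique (LinkVertex (suc q) v) Comparable τ
link-T⇔ {n} {q} {v} v∈W τ = mk⇔ to from
  where
  to : link (T n (suc q)) v τ → Clique (LinkVertex (suc q) v) Comparable τ
  to (v∉τ , face) with T-face⇒ face
  ... | _ ∷ τ⊆W , v~τ ∷ τ-pairs = All.zip (¬Any⇒All¬ τ v∉τ , All.zip (τ⊆W , v~τ)) , τ-pairs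
  from : Clique (LinkVertex (suc q) v) Comparable τ → link (T n (suc q)) v τ
  from (τ-link , τ-pairs) with All.unzip τ-link
  ... | v≢τ , τ-rest with All.unzip τ-rest
  ...   | τ⊆W , v~τ = All¬⇒¬Any v≢τ , T-face⇐ (v∈W ∷ τ⊆W) (v~τ ∷ τ-pairs)

-- The type of a vertex

record InteriorLevels (q : ℕ) (v : Vec ℕ n) (levels : List ℕ) : Set where
  field
    distinct : AllPairs _≢_ levels
    interior : All (λ x → x ≢ 0 × x ≢ q) levels
    cover    : ∀ i → lookup v i ≡ 0 ⊎ lookup v i ≡ q ⊎ lookup v i ∈ levels

count : ℕ → List ℕ → ℕ
count x xs = length (filter (_≟ x) xs)

count-∷ : ∀ x y xs → count x (y ∷ xs) ≡ 𝟙 (y ≟ x) + count x xs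
count-∷ x y xs with y ≟ x
... | yes y≡x = cong length (filter-accept (_≟ x) y≡x)
... | no  y≢x = cong length (filter-reject (_≟ x) y≢x)

count-absent : ∀ {x xs} → All (x <_) xs → count x xs ≡ 0
count-absent {x} {[]}     []           = refl
count-absent {x} {y ∷ xs} (x<y ∷ x<xs) = trans (count-∷ x y xs)
  (cong₂ _+_ (𝟙-no (y ≟ x) (λ y≡x → <-irrefl (sym y≡x) x<y)) (count-absent x<xs))

count-filter : ∀ {P : ℕ → Set} (P? : Decidable P) {x} → P x → ∀ xs →
               count x (filter P? xs) ≡ count x xs
count-filter P? Px []       = refl
count-filter P? {x} Px (y ∷ xs) with P? y
... | yes _  = trans (count-∷ x y (filter P? xs))
                 (trans (cong (𝟙 (y ≟ x) +_) (count-filter P? Px xs)) (sym (count-∷ x y xs)))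
... | no ¬Py = trans (count-filter P? Px xs) (sym (trans (count-∷ x y xs)
                 (cong (_+ count x xs) (𝟙-no (y ≟ x) (λ y≡x → ¬Py (subst _ (sym y≡x) Px))))))

count-toList : ∀ (v : Vec ℕ n) x → count x (toList v) ≡ blockSize (lookup v) x
count-toList Vec.[]       x = refl
count-toList (y Vec.∷ ys) x =
  trans (count-∷ x y (toList ys)) (cong (𝟙 (y ≟ x) +_) (count-toList ys x))

Sorted : List ℕ → Set
Sorted = AllPairs _≤_

sorted-toList : ∀ (v : Vec ℕ n) → (∀ i j → toℕ i ≤ toℕ j → lookup v i ≤ lookup v j) →
                Sorted (toList v)
sorted-toList Vec.[]       _      = []
sorted-toList (y Vec.∷ ys) sorted =
  VecAll.toList⁺ (VecAll.lookup⁻ (λ i → sorted fzero (fsuc i) z≤n))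
  ∷ sorted-toList ys (λ i j i≤j → sorted (fsuc i) (fsuc j) (s≤s i≤j))

runValuesFrom : ℕ → List ℕ → List ℕ
runValuesFrom x []       = x ∷ []
runValuesFrom x (y ∷ ys) = if ⌊ y ≟ x ⌋ then runValuesFrom x ys else x ∷ runValuesFrom y ys

runValues : List ℕ → List ℕ
runValues []       = []
runValues (x ∷ xs) = runValuesFrom x xs

runValuesFrom-All : ∀ {P : ℕ → Set} x ys → All P (x ∷ ys) → All P (runValuesFrom x ys)
runValuesFrom-All x []       Pxs             = Pxs
runValuesFrom-All x (y ∷ ys) (Px ∷ Py ∷ Pys) with y ≟ x
... | yes _ = runValuesFrom-All x ys (Px ∷ Pys)
... | no  _ = Px ∷ runValuesFrom-All y ys (Py ∷ Pys)

runValues-All : ∀ {P : ℕ → Set} xs → All P xs → All P (runValues xs)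
runValues-All []       []  = []
runValues-All (x ∷ xs) Pxs = runValuesFrom-All x xs Pxs

runValuesFrom-complete : ∀ {z} x ys → z ∈ x ∷ ys → z ∈ runValuesFrom x ys
runValuesFrom-complete x []       z∈ = z∈
runValuesFrom-complete x (y ∷ ys) z∈ with y ≟ x | z∈
... | yes _   | here z≡x           = runValuesFrom-complete x ys (here z≡x)
... | yes y≡x | there (here z≡y)   = runValuesFrom-complete x ys (here (trans z≡y y≡x))
... | yes _   | there (there z∈ys) = runValuesFrom-complete x ys (there z∈ys)
... | no  _   | here z≡x           = here z≡x
... | no  _   | there z∈y∷ys       = there (runValuesFrom-complete y ys z∈y∷ys)

runValues-complete : ∀ {z} xs → z ∈ xs → z ∈ runValues xs
runValues-complete (x ∷ xs) = runValuesFrom-complete x xs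

runValuesFrom-increasing : ∀ x ys → Sorted (x ∷ ys) → AllPairs _<_ (runValuesFrom x ys)
runValuesFrom-increasing x []       _                                 = [] ∷ []
runValuesFrom-increasing x (y ∷ ys) ((x≤y ∷ x≤ys) ∷ y≤ys ∷ ys-sorted) with y ≟ x
... | yes _   = runValuesFrom-increasing x ys (x≤ys ∷ ys-sorted)
... | no  y≢x = runValuesFrom-All y ys (x<y ∷ All.map (<-≤-trans x<y) y≤ys)
              ∷ runValuesFrom-increasing y ys (y≤ys ∷ ys-sorted)
  where
  x<y : x < y
  x<y = ≤∧≢⇒< x≤y (y≢x ∘ sym)

runValues-increasing : ∀ xs → Sorted xs → AllPairs _<_ (runValues xs)
runValues-increasing []       _         = []
runValues-increasing (x ∷ xs) xs-sorted = runValuesFrom-increasing x xs xs-sorted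

runsFrom-count : ∀ x c ys → Sorted (x ∷ ys) →
                 runsFrom x c ys ≡ map (λ z → (if ⌊ z ≟ x ⌋ then c else 0) + count z ys)
                                       (runValuesFrom x ys)
runsFrom-count x c [] _ with x ≟ x
... | yes _  = cong (_∷ []) (sym (+-identityʳ c))
... | no x≢x = ⊥-elim (x≢x refl)
runsFrom-count x c (y ∷ ys) ((x≤y ∷ x≤ys) ∷ y≤ys ∷ ys-sorted) with y ≟ x
... | yes refl =
  trans (runsFrom-count x (suc c) ys (x≤ys ∷ ys-sorted)) (map-cong step (runValuesFrom x ys))
  where
  step : ∀ z → (if ⌊ z ≟ x ⌋ then suc c else 0) + count z ys
             ≡ (if ⌊ z ≟ x ⌋ then c else 0) + count z (x ∷ ys)
  step z rewrite count-∷ z x ys | 𝟙-≟-sym x z with z ≟ x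
  ... | yes _ = sym (+-suc c (count z ys))
  ... | no  _ = refl
... | no y≢x = cong₂ _∷_ first (trans (runsFrom-count y 1 ys (y≤ys ∷ ys-sorted))
    (map-cong-local (All.map rest (runValuesFrom-All y ys (x<y ∷ All.map (<-≤-trans x<y) y≤ys)))))
  where
  x<y : x < y
  x<y = ≤∧≢⇒< x≤y (y≢x ∘ sym)
  first : c ≡ (if ⌊ x ≟ x ⌋ then c else 0) + count x (y ∷ ys)
  first with x ≟ x
  ... | yes _  = sym (trans (cong (c +_) (count-absent (x<y ∷ All.map (<-≤-trans x<y) y≤ys)))
                            (+-identityʳ c))
  ... | no x≢x = ⊥-elim (x≢x refl)
  rest : ∀ {z} → x < z → (if ⌊ z ≟ y ⌋ then 1 else 0) + count z ys
                       ≡ (if ⌊ z ≟ x ⌋ then c else 0) + count z (y ∷ ys)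
  rest {z} x<z rewrite count-∷ z y ys | 𝟙-≟-sym y z with z ≟ x
  ... | yes z≡x = ⊥-elim (<-irrefl (sym z≡x) x<z)
  ... | no  _   = refl

runs-count : ∀ xs → Sorted xs → runs xs ≡ map (λ z → count z xs) (runValues xs)
runs-count []       _         = refl
runs-count (x ∷ xs) xs-sorted =
  trans (runsFrom-count x 1 xs xs-sorted) (map-cong step (runValuesFrom x xs))
  where
  step : ∀ z → (if ⌊ z ≟ x ⌋ then 1 else 0) + count z xs ≡ count z (x ∷ xs)
  step z = trans (cong (_+ count z xs) (𝟙-≟-sym z x)) (sym (count-∷ z x xs))

module _ (q : ℕ) (v : Vec ℕ n) (v∈W : InW q v) where

  private
    Interior : ℕ → Set
    Interior x = 1 ≤ x × suc x ≤ q

    interior? : Decidable Interior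
    interior? x = (1 ≤? x) ×-dec (suc x ≤? q)

    interiorValues : List ℕ
    interiorValues = filter interior? (toList v)

    interiorValues-sorted : Sorted interiorValues
    interiorValues-sorted = AllPairs.filter⁺ interior? (sorted-toList v (proj₁ v∈W))

  levelsOf : List ℕ
  levelsOf = runValues interiorValues

  levelsOf-interior : All Interior levelsOf
  levelsOf-interior = runValues-All interiorValues (all-filter interior? (toList v))

  typeOf≡ : typeOf q v ≡ vtype (blockSize (lookup v) 0) (map (blockSize (lookup v)) levelsOf)
                               (blockSize (lookup v) q)
  typeOf≡ = begin
    vtype (count 0 (toList v)) (runs interiorValues) (count q (toList v))
      ≡⟨ cong₂ (λ α₀ αₛ → vtype α₀ (runs interiorValues) αₛ)
               (count-toList v 0) (count-toList v q) ⟩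
    vtype (blockSize (lookup v) 0) (runs interiorValues) (blockSize (lookup v) q)
      ≡⟨ cong (λ mids → vtype (blockSize (lookup v) 0) mids (blockSize (lookup v) q)) mids≡ ⟩
    vtype (blockSize (lookup v) 0) (map (blockSize (lookup v)) levelsOf) (blockSize (lookup v) q) ∎
    where
    open ≡-Reasoning
    mids≡ : runs interiorValues ≡ map (blockSize (lookup v)) levelsOf
    mids≡ = trans (runs-count interiorValues interiorValues-sorted) (map-cong-local (All.map
      (λ {x} x-interior → trans (count-filter interior? x-interior (toList v)) (count-toList v x))
      levelsOf-interior))

  levelsOf-InteriorLevels : InteriorLevels q v levelsOf
  levelsOf-InteriorLevels = record
    { distinct = AllPairs.map (λ x<y x≡y → <-irrefl x≡y x<y)
                              (runValues-increasing interiorValues interiorValues-sorted)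
    ; interior = All.map (λ (1≤x , x<q) → (λ x≡0 → 1+n≰n (subst (1 ≤_) x≡0 1≤x))
                                        , (λ x≡q → 1+n≰n (subst (λ y → suc y ≤ q) x≡q x<q)))
                         levelsOf-interior
    ; cover    = cover
    }
    where
    cover : ∀ i → lookup v i ≡ 0 ⊎ lookup v i ≡ q ⊎ lookup v i ∈ levelsOf
    cover i with lookup v i ≟ 0 | lookup v i ≟ q
    ... | yes vᵢ≡0 | _        = inj₁ vᵢ≡0
    ... | no  _    | yes vᵢ≡q = inj₂ (inj₁ vᵢ≡q)
    ... | no  vᵢ≢0 | no  vᵢ≢q = inj₂ (inj₂ (runValues-complete interiorValues
      (∈-filter⁺ interior? (∈-toList⁺ (∈-lookup i v))
                 (n≢0⇒n>0 vᵢ≢0 , ≤∧≢⇒< (proj₂ v∈W i) vᵢ≢q))))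

-- The link of a vertex

module LinkEncoding {q : ℕ} {v : Vec ℕ n} (v∈W : InW (suc q) v)
                    {levels : List ℕ} (L : InteriorLevels (suc q) v levels) where

  open InteriorLevels L

  top : ℕ
  top = suc q

  V : Fin n → ℕ
  V = lookup v

  α₀ αₛ : ℕ
  α₀ = blockSize V 0
  αₛ = blockSize V top

  lengths : List ℕ
  lengths = (α₀ + αₛ + 1) ∷ map (blockSize V) levels

  Link : Vec ℕ n → Set
  Link = LinkVertex top v

  Represents : Vec ℕ n → ℕ → (Fin n → ℕ) → Set
  Represents w δ d = ∀ i → δ + lookup w i ≡ V i + d i

  lift : Vec ℕ n → ℕ
  lift w = 𝟙 (¬? (v ⊑? w))

  offset : Vec ℕ n → Fin n → ℕ
  offset w i = lift w + lookup w i ∸ V i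

  encodeHead : Vec ℕ n → ℕ
  encodeHead w = lift w + blockSum V 0 (offset w) + blockSum V top (offset w)

  encodeTail : Vec ℕ n → List ℕ
  encodeTail w = map (λ x → blockSum V x (offset w)) levels

  encode : Vec ℕ n → List ℕ
  encode w = encodeHead w ∷ encodeTail w

  -- The number of ones of the offset on the block of value x.  The head c₀ of a chain element
  -- is lift + (ones on the 0-block) + (ones on the top block), where c₀ ≤ α₀ means lift 0 and no
  -- ones on the top block, and c₀ > α₀ means lift 1 and a full 0-block.
  target : List ℕ → ℕ → ℕ
  target []        _ = 0
  target (c₀ ∷ cs) x =
    if ⌊ x ≟ 0 ⌋ then c₀ else if ⌊ x ≟ top ⌋ then c₀ ∸ suc α₀ else lookupAssoc levels cs x

  liftOf : List ℕ → ℕ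
  liftOf []       = 0
  liftOf (c₀ ∷ _) = 𝟙 (α₀ <? c₀)

  offsetOf : List ℕ → Fin n → ℕ
  offsetOf c i = 𝟙 (laterInBlock V i <? target c (V i))

  decode : List ℕ → Vec ℕ n
  decode c = tabulate (λ i → V i + offsetOf c i ∸ liftOf c)

  lift-above : ∀ {w} → v ⊑ w → lift w ≡ 0
  lift-above v⊑w = 𝟙-no (¬? (v ⊑? _)) (λ ¬v⊑w → ¬v⊑w v⊑w)

  lift-notAbove : ∀ {w} → ¬ v ⊑ w → lift w ≡ 1
  lift-notAbove = 𝟙-yes (¬? (v ⊑? _))

  lift≤1 : ∀ w → lift w ≤ 1
  lift≤1 w = 𝟙≤1 (¬? (v ⊑? w))

  rep-above : ∀ {w d} → Represents w 0 d → (∀ i → d i ≤ 1) → v ⊑ w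
  rep-above rep d≤1 = mk⊑ (λ i → subst (V i ≤_) (sym (rep i)) (m≤m+n (V i) _))
                          (λ i → subst (_≤ suc (V i)) (sym (rep i)) (+≤1⇒≤suc (V i) (d≤1 i)))

  rep-below : ∀ {w d} → Represents w 1 d → (∀ i → d i ≤ 1) → w ⊑ v
  rep-below rep d≤1 =
    mk⊑ (λ i → s≤s⁻¹ (subst (_≤ suc (V i)) (sym (rep i)) (+≤1⇒≤suc (V i) (d≤1 i))))
        (λ i → subst (V i ≤_) (sym (rep i)) (m≤m+n (V i) _))

  rep-Comparable : ∀ {w δ d} → Represents w δ d → δ ≤ 1 → (∀ i → d i ≤ 1) → Comparable v w
  rep-Comparable rep z≤n       d≤1 = inj₁ (rep-above rep d≤1)
  rep-Comparable rep (s≤s z≤n) d≤1 = inj₂ (rep-below rep d≤1)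

  link-cases : ∀ {w} → Link w → (v ⊑ w × lift w ≡ 0) ⊎ (w ⊑ v × lift w ≡ 1)
  link-cases (_   , _ , inj₁ v⊑w) = inj₁ (v⊑w , lift-above v⊑w)
  link-cases (v≢w , _ , inj₂ w⊑v) =
    inj₂ (w⊑v , lift-notAbove (λ v⊑w → v≢w (⊑-antisym v⊑w w⊑v)))

  link-rep : ∀ {w} → Link w → Represents w (lift w) (offset w)
  link-rep {w} lw i with link-cases lw
  ... | inj₁ (v⊑w , l≡0) = trans (cong (_+ lookup w i) l≡0)
    (sym (trans (cong (λ l → V i + (l + lookup w i ∸ V i)) l≡0) (m+[n∸m]≡n (⊑-below v⊑w i))))
  ... | inj₂ (w⊑v , l≡1) = trans (cong (_+ lookup w i) l≡1)
    (sym (trans (cong (λ l → V i + (l + lookup w i ∸ V i)) l≡1) (m+[n∸m]≡n (⊑-within w⊑v i))))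

  offset≤1 : ∀ {w} → Link w → ∀ i → offset w i ≤ 1
  offset≤1 {w} lw i with link-cases lw
  ... | inj₁ (v⊑w , l≡0) =
    subst (λ l → l + lookup w i ∸ V i ≤ 1) (sym l≡0) (m≤1+n⇒m∸n≤1 (⊑-within v⊑w i))
  ... | inj₂ (w⊑v , l≡1) =
    subst (λ l → l + lookup w i ∸ V i ≤ 1) (sym l≡1) (m≤1+n⇒m∸n≤1 (s≤s (⊑-below w⊑v i)))

  offset-blockMonotone : ∀ {w} → Link w → BlockMonotone V (offset w)
  offset-blockMonotone {w} (_ , (w-sorted , _) , _) i j i<j Vᵢ≡Vⱼ =
    ∸-mono (+-monoʳ-≤ (lift w) (w-sorted i j (<⇒≤ i<j))) (≤-reflexive (sym Vᵢ≡Vⱼ))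

  offset-top : ∀ {w} → Link w → lift w ≡ 0 → ∀ i → V i ≡ top → offset w i ≡ 0
  offset-top {w} (_ , (_ , w≤top) , _) l≡0 i Vᵢ≡top =
    trans (cong₂ (λ l x → l + lookup w i ∸ x) l≡0 Vᵢ≡top) (m≤n⇒m∸n≡0 (w≤top i))

  offset-bottom : ∀ {w} → Link w → lift w ≡ 1 → ∀ i → V i ≡ 0 → offset w i ≡ 1
  offset-bottom {w} lw l≡1 i Vᵢ≡0 = ≤-antisym (offset≤1 lw i)
    (subst (1 ≤_) (sym (cong₂ (λ l x → l + lookup w i ∸ x) l≡1 Vᵢ≡0)) (s≤s z≤n))

  head-above : ∀ {w} → Link w → lift w ≡ 0 → encodeHead w ≡ blockSum V 0 (offset w)
  head-above {w} lw l≡0 = trans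
    (cong₂ (λ l s → l + blockSum V 0 (offset w) + s) l≡0 (blockSum-0 V top (offset-top lw l≡0)))
    (+-identityʳ _)

  head-above≤α₀ : ∀ {w} → Link w → lift w ≡ 0 → encodeHead w ≤ α₀
  head-above≤α₀ lw l≡0 =
    subst (_≤ α₀) (sym (head-above lw l≡0)) (blockSum≤blockSize V 0 (offset≤1 lw))

  head-below : ∀ {w} → Link w → lift w ≡ 1 → encodeHead w ≡ suc (α₀ + blockSum V top (offset w))
  head-below {w} lw l≡1 =
    cong₂ (λ l s → l + s + blockSum V top (offset w)) l≡1 (blockSum-cong V 0 (offset-bottom lw l≡1))

  liftOf-encode : ∀ {w} → Link w → liftOf (encode w) ≡ lift w
  liftOf-encode {w} lw with n≤1⇒n≡0∨n≡1 (lift≤1 w)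
  ... | inj₁ l≡0 = trans (𝟙-no (α₀ <? _) (≤⇒≯ (head-above≤α₀ lw l≡0))) (sym l≡0)
  ... | inj₂ l≡1 = trans (𝟙-yes (α₀ <? _) (subst (α₀ <_) (sym (head-below lw l≡1)) (s≤s (m≤m+n α₀ _))))
                         (sym l≡1)

  target-top : ∀ c₀ cs → target (c₀ ∷ cs) top ≡ c₀ ∸ suc α₀
  target-top c₀ cs with top ≟ top
  ... | yes _      = refl
  ... | no top≢top = ⊥-elim (top≢top refl)

  target-level : ∀ c₀ cs {x} → x ≢ 0 × x ≢ top → target (c₀ ∷ cs) x ≡ lookupAssoc levels cs x
  target-level c₀ cs {x} (x≢0 , x≢top) with x ≟ 0 | x ≟ top
  ... | yes x≡0 | _         = ⊥-elim (x≢0 x≡0)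
  ... | no _    | yes x≡top = ⊥-elim (x≢top x≡top)
  ... | no _    | no _      = refl

  target-mono : ∀ {c c′} → c ≤P c′ → ∀ x → target c x ≤ target c′ x
  target-mono []                x = z≤n
  target-mono (c₀≤c₀′ ∷ cs≤cs′) x with x ≟ 0 | x ≟ top
  ... | yes _ | _     = c₀≤c₀′
  ... | no _  | yes _ = ∸-monoˡ-≤ (suc α₀) c₀≤c₀′
  ... | no _  | no _  = lookupAssoc-mono levels x cs≤cs′

  offsetOf-encode-suffix : ∀ {w} → Link w → ∀ i →
                           target (encode w) (V i) ≡ blockSum V (V i) (offset w) →
                           offsetOf (encode w) i ≡ offset w i
  offsetOf-encode-suffix {w} lw i eq = trans (cong (λ t → 𝟙 (laterInBlock V i <? t)) eq)
    (sym (blockMonotone⇒suffix V (offset w) (offset≤1 lw) (offset-blockMonotone lw) i))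

  offsetOf-encode-bottom : ∀ {w} → Link w → ∀ i → V i ≡ 0 → offsetOf (encode w) i ≡ offset w i
  offsetOf-encode-bottom {w} lw i Vᵢ≡0 with n≤1⇒n≡0∨n≡1 (lift≤1 w)
  ... | inj₁ l≡0 = offsetOf-encode-suffix lw i (begin
    target (encode w) (V i)     ≡⟨ cong (target (encode w)) Vᵢ≡0 ⟩
    encodeHead w                ≡⟨ head-above lw l≡0 ⟩
    blockSum V 0 (offset w)     ≡⟨ cong (λ x → blockSum V x (offset w)) Vᵢ≡0 ⟨
    blockSum V (V i) (offset w) ∎)
    where open ≡-Reasoning
  ... | inj₂ l≡1 = trans (𝟙-yes (_ <? _) (begin-strict
    laterInBlock V i                     <⟨ laterInBlock<blockSize V i ⟩
    blockSize V (V i)                    ≡⟨ cong (blockSize V) Vᵢ≡0 ⟩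
    α₀                                   <⟨ s≤s (m≤m+n α₀ _) ⟩
    suc (α₀ + blockSum V top (offset w)) ≡⟨ head-below lw l≡1 ⟨
    encodeHead w                         ≡⟨ cong (target (encode w)) Vᵢ≡0 ⟨
    target (encode w) (V i)              ∎))
    (sym (offset-bottom lw l≡1 i Vᵢ≡0))
    where open ≤-Reasoning

  offsetOf-encode-top : ∀ {w} → Link w → ∀ i → V i ≡ top → offsetOf (encode w) i ≡ offset w i
  offsetOf-encode-top {w} lw i Vᵢ≡top with n≤1⇒n≡0∨n≡1 (lift≤1 w)
  ... | inj₁ l≡0 = trans (𝟙-no (_ <? _) (n≮0 ∘ subst (laterInBlock V i <_) (begin
    target (encode w) (V i) ≡⟨ cong (target (encode w)) Vᵢ≡top ⟩
    target (encode w) top   ≡⟨ target-top (encodeHead w) (encodeTail w) ⟩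
    encodeHead w ∸ suc α₀   ≡⟨ m≤n⇒m∸n≡0 (m≤n⇒m≤1+n (head-above≤α₀ lw l≡0)) ⟩
    0                       ∎)))
    (sym (offset-top lw l≡0 i Vᵢ≡top))
    where open ≡-Reasoning
  ... | inj₂ l≡1 = offsetOf-encode-suffix lw i (begin
    target (encode w) (V i)                     ≡⟨ cong (target (encode w)) Vᵢ≡top ⟩
    target (encode w) top                       ≡⟨ target-top (encodeHead w) (encodeTail w) ⟩
    encodeHead w ∸ suc α₀                       ≡⟨ cong (_∸ suc α₀) (head-below lw l≡1) ⟩
    suc α₀ + blockSum V top (offset w) ∸ suc α₀ ≡⟨ m+n∸m≡n (suc α₀) _ ⟩
    blockSum V top (offset w)                   ≡⟨ cong (λ x → blockSum V x (offset w)) Vᵢ≡top ⟨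
    blockSum V (V i) (offset w)                 ∎)
    where open ≡-Reasoning

  offsetOf-encode : ∀ {w} → Link w → ∀ i → offsetOf (encode w) i ≡ offset w i
  offsetOf-encode {w} lw i with cover i
  ... | inj₁ Vᵢ≡0             = offsetOf-encode-bottom lw i Vᵢ≡0
  ... | inj₂ (inj₁ Vᵢ≡top)    = offsetOf-encode-top lw i Vᵢ≡top
  ... | inj₂ (inj₂ Vᵢ∈levels) = offsetOf-encode-suffix lw i
    (trans (target-level _ _ (All.lookup interior Vᵢ∈levels))
           (lookupAssoc-map (λ x → blockSum V x (offset w)) Vᵢ∈levels))

  decode-encode : ∀ {w} → Link w → decode (encode w) ≡ w
  decode-encode {w} lw = lookup-ext λ i → begin
    lookup (decode (encode w)) i                    ≡⟨ lookup∘tabulate _ i ⟩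
    V i + offsetOf (encode w) i ∸ liftOf (encode w) ≡⟨ cong₂ (λ o l → V i + o ∸ l)
                                                         (offsetOf-encode lw i) (liftOf-encode lw) ⟩
    V i + offset w i ∸ lift w                       ≡⟨ cong (_∸ lift w) (link-rep lw i) ⟨
    lift w + lookup w i ∸ lift w                    ≡⟨ m+n∸m≡n (lift w) _ ⟩
    lookup w i                                      ∎
    where open ≡-Reasoning

  decode-const : ∀ {c k} → liftOf c ≡ k → (∀ i → offsetOf c i ≡ k) → decode c ≡ v
  decode-const {c} {k} l≡k o≡k = lookup-ext λ i → trans (lookup∘tabulate _ i)
    (trans (cong₂ (λ o l → V i + o ∸ l) (o≡k i) l≡k) (m+n∸n≡m (V i) k))

  decode-bottom : decode (replicate (length lengths) 0) ≡ v
  decode-bottom = decode-const (𝟙-no (α₀ <? 0) λ ())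
    (λ i → 𝟙-no (_ <? _) (n≮0 ∘ subst (laterInBlock V i <_) (target-bottom (V i))))
    where
    target-bottom : ∀ x → target (replicate (length lengths) 0) x ≡ 0
    target-bottom x with x ≟ 0 | x ≟ top
    ... | yes _ | _     = refl
    ... | no _  | yes _ = refl
    ... | no _  | no _  = lookupAssoc-replicate-0 levels _ x

  α₀+αₛ+1≡suc : α₀ + αₛ + 1 ≡ suc (α₀ + αₛ)
  α₀+αₛ+1≡suc = +-comm (α₀ + αₛ) 1

  decode-top : decode lengths ≡ v
  decode-top = decode-const
    (𝟙-yes (α₀ <? _) (subst (α₀ <_) (sym α₀+αₛ+1≡suc) (s≤s (m≤m+n α₀ αₛ))))
    (λ i → 𝟙-yes (_ <? _) (<-≤-trans (laterInBlock<blockSize V i) (size≤target i)))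
    where
    size≤target : ∀ i → blockSize V (V i) ≤ target lengths (V i)
    size≤target i with cover i
    ... | inj₁ Vᵢ≡0 rewrite Vᵢ≡0 = ≤-trans (m≤m+n α₀ αₛ) (m≤m+n _ 1)
    ... | inj₂ (inj₁ Vᵢ≡top) rewrite Vᵢ≡top | target-top (α₀ + αₛ + 1) (map (blockSize V) levels)
                                           | α₀+αₛ+1≡suc =
      ≤-reflexive (sym (m+n∸m≡n (suc α₀) αₛ))
    ... | inj₂ (inj₂ Vᵢ∈levels) = ≤-reflexive (sym (trans
      (target-level _ _ (All.lookup interior Vᵢ∈levels)) (lookupAssoc-map (blockSize V) Vᵢ∈levels)))

  encode∈P̄ : ∀ {w} → Link w → InPbar lengths (encode w)
  encode∈P̄ {w} lw@(v≢w , _) = (head≤ ∷ tail≤) , encode≢ decode-bottom , encode≢ decode-top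
    where
    head≤ : encodeHead w ≤ α₀ + αₛ + 1
    head≤ = ≤-trans (+-mono-≤ (+-mono-≤ (lift≤1 w) (blockSum≤blockSize V 0 (offset≤1 lw)))
                              (blockSum≤blockSize V top (offset≤1 lw)))
                    (≤-reflexive (sym α₀+αₛ+1≡suc))
    tail≤ : Pointwise _≤_ (encodeTail w) (map (blockSize V) levels)
    tail≤ = Pointwise.map⁺ _ _ (Pointwise.refl (λ {x} → blockSum≤blockSize V x (offset≤1 lw)))
    encode≢ : ∀ {c} → decode c ≡ v → encode w ≢ c
    encode≢ decode≡v encode≡c =
      v≢w (sym (trans (sym (decode-encode lw)) (trans (cong decode encode≡c) decode≡v)))

  liftOf≤1 : ∀ c → liftOf c ≤ 1
  liftOf≤1 []      = z≤n
  liftOf≤1 (_ ∷ _) = 𝟙≤1 _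

  offsetOf≤1 : ∀ c i → offsetOf c i ≤ 1
  offsetOf≤1 c i = 𝟙≤1 _

  offsetOf-blockMonotone : ∀ c → BlockMonotone V (offsetOf c)
  offsetOf-blockMonotone c i j i<j Vᵢ≡Vⱼ = 𝟙-mono (_ <? _) (_ <? _) λ laterᵢ<target →
    ≤-<-trans (laterInBlock-anti V i j (<⇒≤ i<j) Vᵢ≡Vⱼ)
              (subst (λ x → laterInBlock V i < target c x) Vᵢ≡Vⱼ laterᵢ<target)

  blockSum-offsetOf : ∀ c x → blockSum V x (offsetOf c) ≡ target c x ⊓ blockSize V x
  blockSum-offsetOf c x = trans
    (blockSum-cong V x (λ i Vᵢ≡x → cong (λ y → 𝟙 (laterInBlock V i <? target c y)) Vᵢ≡x))
    (blockSum-suffix V x (target c x))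

  offsetOf-zero : ∀ c x → target c x < blockSize V x → ∃ λ i → offsetOf c i ≡ 0
  offsetOf-zero c x target<size with blockSum<blockSize⇒∃0 V x (offsetOf≤1 c)
    (subst (_< blockSize V x) (sym (blockSum-offsetOf c x)) (≤-<-trans (m⊓n≤m _ _) target<size))
  ... | i , _ , offsetᵢ≡0 = i , offsetᵢ≡0

  offsetOf-top : ∀ c → liftOf c ≡ 0 → ∀ i → V i ≡ top → offsetOf c i ≡ 0
  offsetOf-top []        _   i _      = 𝟙-no (laterInBlock V i <? 0) n≮0
  offsetOf-top (c₀ ∷ cs) l≡0 i Vᵢ≡top =
    𝟙-no (_ <? _) (n≮0 ∘ subst (laterInBlock V i <_) target≡0)
    where
    c₀≤α₀ : c₀ ≤ α₀
    c₀≤α₀ = ≮⇒≥ λ α₀<c₀ → 0≢1+n (trans (sym l≡0) (𝟙-yes (α₀ <? c₀) α₀<c₀))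
    target≡0 : target (c₀ ∷ cs) (V i) ≡ 0
    target≡0 = trans (cong (target (c₀ ∷ cs)) Vᵢ≡top)
                     (trans (target-top c₀ cs) (m≤n⇒m∸n≡0 (m≤n⇒m≤1+n c₀≤α₀)))

  liftOf≤ : ∀ c i → liftOf c ≤ V i + offsetOf c i
  liftOf≤ []        i = z≤n
  liftOf≤ (c₀ ∷ cs) i with α₀ <? c₀
  ... | no  _     = z≤n
  ... | yes α₀<c₀ = positive (V i ≟ 0)
    where
    positive : Dec (V i ≡ 0) → 1 ≤ V i + offsetOf (c₀ ∷ cs) i
    positive (no  Vᵢ≢0) = ≤-trans (n≢0⇒n>0 Vᵢ≢0) (m≤m+n (V i) _)
    positive (yes Vᵢ≡0) = ≤-trans (≤-reflexive (sym (𝟙-yes (_ <? _) later<target))) (m≤n+m _ (V i))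
      where
      later<target : laterInBlock V i < target (c₀ ∷ cs) (V i)
      later<target = begin-strict
        laterInBlock V i           <⟨ laterInBlock<blockSize V i ⟩
        blockSize V (V i)          ≡⟨ cong (blockSize V) Vᵢ≡0 ⟩
        α₀                         <⟨ α₀<c₀ ⟩
        c₀                         ≡⟨ cong (target (c₀ ∷ cs)) Vᵢ≡0 ⟨
        target (c₀ ∷ cs) (V i)     ∎
        where open ≤-Reasoning

  decode-rep : ∀ c → Represents (decode c) (liftOf c) (offsetOf c)
  decode-rep c i = trans (cong (liftOf c +_) (lookup∘tabulate _ i)) (m+[n∸m]≡n (liftOf≤ c i))

  decode∈W : ∀ c → InW top (decode c)
  decode∈W c = decode-sorted , decode-bounded
    where
    lifted-sorted : ∀ i j → toℕ i ≤ toℕ j → V i + offsetOf c i ≤ V j + offsetOf c j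
    lifted-sorted i j i≤j with m≤n⇒m<n∨m≡n (proj₁ v∈W i j i≤j)
    ... | inj₁ Vᵢ<Vⱼ =
      ≤-trans (+≤1⇒≤suc (V i) (offsetOf≤1 c i)) (≤-trans Vᵢ<Vⱼ (m≤m+n (V j) _))
    ... | inj₂ Vᵢ≡Vⱼ with m≤n⇒m<n∨m≡n i≤j
    ...   | inj₁ i<j = +-mono-≤ (≤-reflexive Vᵢ≡Vⱼ) (offsetOf-blockMonotone c i j i<j Vᵢ≡Vⱼ)
    ...   | inj₂ i≡j rewrite toℕ-injective i≡j = ≤-refl
    decode-sorted : ∀ i j → toℕ i ≤ toℕ j → lookup (decode c) i ≤ lookup (decode c) j
    decode-sorted i j i≤j rewrite lookup∘tabulate (λ k → V k + offsetOf c k ∸ liftOf c) i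
                                | lookup∘tabulate (λ k → V k + offsetOf c k ∸ liftOf c) j =
      ∸-monoˡ-≤ (liftOf c) (lifted-sorted i j i≤j)
    decode-bounded : ∀ i → lookup (decode c) i ≤ top
    decode-bounded i with m≤n⇒m<n∨m≡n (proj₂ v∈W i) | n≤1⇒n≡0∨n≡1 (liftOf≤1 c)
    ... | inj₁ Vᵢ<top | _ = subst (_≤ top) (sym (lookup∘tabulate _ i))
      (≤-trans (m∸n≤m _ (liftOf c)) (≤-trans (+≤1⇒≤suc (V i) (offsetOf≤1 c i)) Vᵢ<top))
    ... | inj₂ Vᵢ≡top | inj₁ l≡0 = ≤-reflexive (begin
      lookup (decode c) i            ≡⟨ cong (_+ lookup (decode c) i) l≡0 ⟨
      liftOf c + lookup (decode c) i ≡⟨ decode-rep c i ⟩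
      V i + offsetOf c i             ≡⟨ cong₂ _+_ Vᵢ≡top (offsetOf-top c l≡0 i Vᵢ≡top) ⟩
      top + 0                        ≡⟨ +-identityʳ top ⟩
      top                            ∎)
      where open ≡-Reasoning
    ... | inj₂ Vᵢ≡top | inj₂ l≡1 = s≤s⁻¹ (begin
      suc (lookup (decode c) i)      ≡⟨ cong (_+ lookup (decode c) i) l≡1 ⟨
      liftOf c + lookup (decode c) i ≡⟨ decode-rep c i ⟩
      V i + offsetOf c i             ≡⟨ cong (_+ offsetOf c i) Vᵢ≡top ⟩
      top + offsetOf c i             ≤⟨ +≤1⇒≤suc top (offsetOf≤1 c i) ⟩
      suc top                        ∎)
      where open ≤-Reasoning

  P̄-offset-zero : ∀ {c} → InPbar lengths c → liftOf c ≡ 1 → ∃ λ i → offsetOf c i ≡ 0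
  P̄-offset-zero {c₀ ∷ cs} ((c₀≤ ∷ cs≤) , _ , c≢top) l≡1 with m≤n⇒m<n∨m≡n c₀≤
  ... | inj₁ c₀<top = offsetOf-zero (c₀ ∷ cs) top (subst (_< αₛ) (sym (target-top c₀ cs))
    (+-cancelˡ-< (suc α₀) _ _ (subst (_< suc α₀ + αₛ) (sym (m+[n∸m]≡n α₀<c₀))
                                     (subst (c₀ <_) α₀+αₛ+1≡suc c₀<top))))
    where
    α₀<c₀ : α₀ < c₀
    α₀<c₀ = 𝟙≡1⇒ (α₀ <? c₀) l≡1
  ... | inj₂ c₀≡top with lookupAssoc-< (blockSize V) distinct cs≤ (c≢top ∘ cong₂ _∷_ c₀≡top)
  ...   | x , x∈levels , lookup<size = offsetOf-zero (c₀ ∷ cs) x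
    (subst (_< blockSize V x) (sym (target-level c₀ cs (All.lookup interior x∈levels))) lookup<size)

  lift-decode : ∀ {c} → InPbar lengths c → lift (decode c) ≡ liftOf c
  lift-decode {c} c∈P̄ with n≤1⇒n≡0∨n≡1 (liftOf≤1 c)
  ... | inj₁ l≡0 = trans (lift-above (rep-above rep₀ (offsetOf≤1 c))) (sym l≡0)
    where
    rep₀ : Represents (decode c) 0 (offsetOf c)
    rep₀ = subst (λ δ → Represents (decode c) δ (offsetOf c)) l≡0 (decode-rep c)
  ... | inj₂ l≡1 with P̄-offset-zero c∈P̄ l≡1
  ...   | i , offsetᵢ≡0 = trans (lift-notAbove (λ v⊑d → 1+n≰n (≤-trans (s≤s (⊑-below v⊑d i))
                                                                  (≤-reflexive 1+dᵢ≡Vᵢ))))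
                                (sym l≡1)
    where
    1+dᵢ≡Vᵢ : suc (lookup (decode c) i) ≡ V i
    1+dᵢ≡Vᵢ = trans (cong (_+ lookup (decode c) i) (sym l≡1))
                (trans (decode-rep c i) (trans (cong (V i +_) offsetᵢ≡0) (+-identityʳ (V i))))

  offset-decode : ∀ {c} → InPbar lengths c → ∀ i → offset (decode c) i ≡ offsetOf c i
  offset-decode {c} c∈P̄ i = begin
    lift (decode c) + lookup (decode c) i ∸ V i ≡⟨ cong (λ l → l + lookup (decode c) i ∸ V i)
                                                       (lift-decode c∈P̄) ⟩
    liftOf c + lookup (decode c) i ∸ V i        ≡⟨ cong (_∸ V i) (decode-rep c i) ⟩
    V i + offsetOf c i ∸ V i                    ≡⟨ m+n∸m≡n (V i) _ ⟩
    offsetOf c i                                ∎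
    where open ≡-Reasoning

  blockSum-offset-decode : ∀ {c} → InPbar lengths c → ∀ x →
                           blockSum V x (offset (decode c)) ≡ target c x ⊓ blockSize V x
  blockSum-offset-decode {c} c∈P̄ x =
    trans (blockSum-cong V x (λ i _ → offset-decode c∈P̄ i)) (blockSum-offsetOf c x)

  encode-decode : ∀ {c} → InPbar lengths c → encode (decode c) ≡ c
  encode-decode {c₀ ∷ cs} c∈P̄@((c₀≤ ∷ cs≤) , _) = cong₂ _∷_ head tail
    where
    head : encodeHead (decode (c₀ ∷ cs)) ≡ c₀
    head = begin
      encodeHead (decode (c₀ ∷ cs))
        ≡⟨ cong₂ _+_ (cong₂ _+_ (lift-decode c∈P̄) (blockSum-offset-decode c∈P̄ 0))
                     (trans (blockSum-offset-decode c∈P̄ top) (cong (_⊓ αₛ) (target-top c₀ cs))) ⟩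
      𝟙 (α₀ <? c₀) + c₀ ⊓ α₀ + (c₀ ∸ suc α₀) ⊓ αₛ
        ≡⟨ chain-split α₀ αₛ c₀ c₀≤ ⟩
      c₀ ∎
      where open ≡-Reasoning
    tail : encodeTail (decode (c₀ ∷ cs)) ≡ cs
    tail = trans (map-cong-local (All.map (λ {x} x-interior → trans (blockSum-offset-decode c∈P̄ x)
                   (cong (_⊓ blockSize V x) (target-level c₀ cs x-interior))) interior))
                 (map-lookupAssoc-⊓ (blockSize V) distinct cs≤)

  encode-v : encode v ≡ replicate (length lengths) 0
  encode-v = cong₂ _∷_
    (cong₂ _+_ (cong₂ _+_ (lift-above ⊑-refl) (blockSum-0 V 0 (λ i _ → offset-v i)))
               (blockSum-0 V top (λ i _ → offset-v i)))
    (trans (map≡replicate (All.tabulate λ {x} _ → blockSum-0 V x (λ i _ → offset-v i)))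
           (cong (λ m → replicate m 0) (sym (length-map (blockSize V) levels))))
    where
    offset-v : ∀ i → offset v i ≡ 0
    offset-v i = trans (cong (λ l → l + V i ∸ V i) (lift-above ⊑-refl)) (n∸n≡0 (V i))

  decode∈Link : ∀ {c} → InPbar lengths c → Link (decode c)
  decode∈Link {c} c∈P̄@(_ , c≢bottom , _) =
    v≢decode , decode∈W c , rep-Comparable (decode-rep c) (liftOf≤1 c) (offsetOf≤1 c)
    where
    v≢decode : v ≢ decode c
    v≢decode v≡d =
      c≢bottom (trans (sym (encode-decode c∈P̄)) (trans (cong encode (sym v≡d)) encode-v))

  _≼_ : Vec ℕ n → Vec ℕ n → Set
  w ≼ w′ = lift w ≤ lift w′ × (∀ i → offset w i ≤ offset w′ i)

  encode-mono : ∀ {w w′} → w ≼ w′ → encode w ≤P encode w′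
  encode-mono {w} {w′} (l≤l′ , o≤o′) =
    +-mono-≤ (+-mono-≤ l≤l′ (on-block 0)) (on-block top)
    ∷ Pointwise.map⁺ _ _ (Pointwise.refl (λ {x} → on-block x))
    where
    on-block : ∀ x → blockSum V x (offset w) ≤ blockSum V x (offset w′)
    on-block x = blockSum-mono V x (λ i _ → o≤o′ i)

  liftOf-mono : ∀ {c c′} → c ≤P c′ → liftOf c ≤ liftOf c′
  liftOf-mono []           = z≤n
  liftOf-mono (c₀≤c₀′ ∷ _) = 𝟙-mono (_ <? _) (_ <? _) (λ α₀<c₀ → <-≤-trans α₀<c₀ c₀≤c₀′)

  offsetOf-mono : ∀ {c c′} → c ≤P c′ → ∀ i → offsetOf c i ≤ offsetOf c′ i
  offsetOf-mono c≤c′ i =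
    𝟙-mono (_ <? _) (_ <? _) (λ later< → <-≤-trans later< (target-mono c≤c′ (V i)))

  encode-reflects : ∀ {w w′} → Link w → Link w′ → encode w ≤P encode w′ → w ≼ w′
  encode-reflects lw lw′ le =
    subst₂ _≤_ (liftOf-encode lw) (liftOf-encode lw′) (liftOf-mono le) ,
    λ i → subst₂ _≤_ (offsetOf-encode lw i) (offsetOf-encode lw′ i) (offsetOf-mono le i)

  ⊑⇒≼ : ∀ {w w′} → Link w → Link w′ → w ⊑ w′ → w ≼ w′ ⊎ w′ ≼ w
  ⊑⇒≼ {w} {w′} lw lw′ w⊑w′ with lift w ≤? lift w′
  ... | yes l≤l′ = inj₁ (l≤l′ , λ i →
    rep-cancel (V i) (link-rep lw i) (link-rep lw′ i) (+-mono-≤ l≤l′ (⊑-below w⊑w′ i)))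
  ... | no  l≰l′ = inj₂ (<⇒≤ l′<l , λ i → rep-cancel (V i) (link-rep lw′ i) (link-rep lw i)
    (subst₂ (λ l l′ → l′ + lookup w′ i ≤ l + lookup w i) (sym l≡1) (sym l′≡0)
            (⊑-within w⊑w′ i)))
    where
    l′<l : lift w′ < lift w
    l′<l = ≰⇒> l≰l′
    l≡1 : lift w ≡ 1
    l≡1 = ≤-antisym (lift≤1 w) (≤-trans (s≤s z≤n) l′<l)
    l′≡0 : lift w′ ≡ 0
    l′≡0 = n<1⇒n≡0 (<-≤-trans l′<l (lift≤1 w))

  Comparable⇒≼ : ∀ {w w′} → Link w → Link w′ → Comparable w w′ → w ≼ w′ ⊎ w′ ≼ w
  Comparable⇒≼ lw lw′ (inj₁ w⊑w′) = ⊑⇒≼ lw lw′ w⊑w′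
  Comparable⇒≼ lw lw′ (inj₂ w′⊑w) = swap (⊑⇒≼ lw′ lw w′⊑w)

  ≼⇒Comparable : ∀ {w w′} → Link w → Link w′ → w ≼ w′ → Comparable w w′
  ≼⇒Comparable {w} {w′} lw lw′ (l≤l′ , o≤o′) with ≤1-cases l≤l′ (lift≤1 w′)
  ... | inj₁ l≡l′ = inj₁ (mk⊑ below within)
    where
    rep′ : ∀ i → lift w + lookup w′ i ≡ V i + offset w′ i
    rep′ i = trans (cong (_+ lookup w′ i) l≡l′) (link-rep lw′ i)
    below : ∀ i → lookup w i ≤ lookup w′ i
    below i = +-cancelˡ-≤ (lift w) _ _ (rep-uncancel (V i) (link-rep lw i) (rep′ i) (o≤o′ i))
    within : ∀ i → lookup w′ i ≤ suc (lookup w i)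
    within i = +-cancelˡ-≤ (lift w) _ _ (≤-trans
      (rep-uncancel-suc (V i) (link-rep lw i) (rep′ i) (≤-trans (offset≤1 lw′ i) (s≤s z≤n)))
      (≤-reflexive (sym (+-suc (lift w) (lookup w i)))))
  ... | inj₂ (l≡0 , l′≡1) = inj₂ (mk⊑ below within)
    where
    below : ∀ i → lookup w′ i ≤ lookup w i
    below i = s≤s⁻¹ (subst₂ (λ l l′ → l′ + lookup w′ i ≤ suc (l + lookup w i)) l≡0 l′≡1
      (rep-uncancel-suc (V i) (link-rep lw i) (link-rep lw′ i) (≤-trans (offset≤1 lw′ i) (s≤s z≤n))))
    within : ∀ i → lookup w i ≤ suc (lookup w′ i)
    within i = subst₂ (λ l l′ → l + lookup w i ≤ l′ + lookup w′ i) l≡0 l′≡1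
      (rep-uncancel (V i) (link-rep lw i) (link-rep lw′ i) (o≤o′ i))

  encode-edge⇔ : ∀ {w w′} → Link w → Link w′ →
                 Comparable w w′ ⇔ (encode w ≤P encode w′ ⊎ encode w′ ≤P encode w)
  encode-edge⇔ lw lw′ = mk⇔
    (Sum.map encode-mono encode-mono ∘ Comparable⇒≼ lw lw′)
    [ ≼⇒Comparable lw lw′ ∘ encode-reflects lw lw′
    , Comparable-sym ∘ ≼⇒Comparable lw′ lw ∘ encode-reflects lw′ lw ]′

  linkGraph≅chainGraph : GraphIso Link Comparable (InPbar lengths) (λ c c′ → c ≤P c′ ⊎ c′ ≤P c)
  linkGraph≅chainGraph = record
    { to          = encode
    ; from        = decode
    ; to-vertex   = encode∈P̄
    ; from-vertex = decode∈Link
    ; from∘to     = decode-encode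
    ; to∘from     = encode-decode
    ; edge⇔       = encode-edge⇔
    }

  link≅Δbar : link (T n top) v ≅ Δbar lengths
  link≅Δbar = ≅-cong-⇔ (link-T⇔ v∈W) (clique-≅ linkGraph≅chainGraph)

mainTheorem2 : (k q : ℕ) → 2 ≤ k → 1 ≤ q →
    (v : Vec ℕ (k ∸ 1)) → InW q v →
    (α₀ : ℕ) (mids : List ℕ) (αₛ : ℕ) → typeOf q v ≡ vtype α₀ mids αₛ →
    link (T (k ∸ 1) q) v ≅ Δbar (chainLengths (vtype α₀ mids αₛ))
mainTheorem2 k (suc q) _ _ v v∈W α₀ mids αₛ type≡ with trans (sym type≡) (typeOf≡ (suc q) v v∈W)
... | refl = LinkEncoding.link≅Δbar v∈W (levelsOf-InteriorLevels (suc q) v v∈W)
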